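{- Let $z_n=\sum_{\pi\in\mathcal{D}_{3\text{ - }12}(n)}y^{\mu(\pi)}$ for $n\ge2$, with $z_1=0$, and for $1\le i<j\le n$ let $z_{n,i,j}$ be the same sum restricted to those $\pi$ whose last cycle (in standard cycle form) starts with $i$ and ends with $j$. Then for $n\ge3$, $$z_{n,i,j}=\sum_{\ell=j}^{n-1}z_{n-1,i,\ell},\qquad 1\le i<j\le n-1,$$ $$z_{n,i,n}=\sum_{\ell=i+1}^{n-1}z_{n-1,i,\ell}+y\sum_{\ell=1}^{i-1}z_{n-1,\ell,i},\qquad 1\le i\le n-2,$$ and $z_{n,n-1,n}=yz_{n-2}$, with initial condition $z_{2,1,2}=y$.
   Context: Every permutation $\pi$ of $[n]=\{1,\dots,n\}$ is written in standard cycle form: each cycle is written starting with its smallest element, and the cycles are ordered from left to right by increasing first elements. The flattened form $\mathrm{flat}(\pi)$ is the word (in one-line notation) obtained by erasing the parentheses of the standard cycle form. A derangement is a permutation with no fixed points; $\mathcal{D}(n)$ is the set of derangements of $[n]$, and $\mu(\pi)$ denotes the number of cycles of $\pi$. A word $w=w_1\cdots w_n$ of distinct integers contains the vincular pattern $3\text{ - }12$ if there are indices $i<j$ with $j+1\le n$ and $w_j<w_{j+1}<w_i$, and avoids it otherwise. $\mathcal{D}_{3\text{ - }12}(n)$ is the set of $\pi\in\mathcal{D}(n)$ such that $\mathrm{flat}(\pi)$ avoids $3\text{ - }12$. -}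

module Defs where

open import Data.Bool using (Bool; true; false; _∧_; _∨_; not; if_then_else_)
open import Data.Nat using (ℕ; zero; suc; _+_; _∸_; _≡ᵇ_; _<ᵇ_)
open import Data.List using (List; []; _∷_; _++_; length; map; concat; concatMap;
  applyUpTo; upTo; filterᵇ)
open import Data.Bool.ListAction using (any; all)
open import Data.Nat.ListAction using (sum)

-- Integer interval [a..b] (empty if b < a)
fromTo : ℕ → ℕ → List ℕ
fromTo a b = applyUpTo (a +_) (suc b ∸ a)

-- 0-indexed access into a word, default 0 (entries of our words are ≥ 1)
at : List ℕ → ℕ → ℕ
at []       _       = 0
at (x ∷ _)  zero    = x
at (_ ∷ xs) (suc k) = at xs k

words : ℕ → ℕ → List (List ℕ)
words m zero    = [] ∷ []
words m (suc k) = concatMap (λ a → map (a ∷_) (words m k)) (fromTo 1 m)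

distinct : List ℕ → Bool
distinct []       = true
distinct (x ∷ xs) = not (any (x ≡ᵇ_) xs) ∧ distinct xs

-- permutations of [n] in one-line notation: w = π(1) π(2) ... π(n)
perms : ℕ → List (List ℕ)
perms n = filterᵇ distinct (words n n)

app : List ℕ → ℕ → ℕ
app w x = at w (x ∸ 1)

cycleFrom : List ℕ → ℕ → List ℕ
cycleFrom w s = s ∷ go (length w) (app w s)
  where
  go : ℕ → ℕ → List ℕ
  go zero    x = []
  go (suc f) x = if x ≡ᵇ s then [] else x ∷ go f (app w x)

-- standard cycle form: scan 1..n, open a new cycle at each not-yet-visited
-- element (which is then the smallest element of its cycle)
cycles : List ℕ → List (List ℕ)
cycles w = go (fromTo 1 (length w)) []
  where
  go : List ℕ → List ℕ → List (List ℕ)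
  go []       vis = []
  go (i ∷ is) vis =
    if any (i ≡ᵇ_) vis then go is vis
    else cycleFrom w i ∷ go is (cycleFrom w i ++ vis)

flat : List ℕ → List ℕ
flat w = concat (cycles w)

μ : List ℕ → ℕ
μ w = length (cycles w)

isDerangement : List ℕ → Bool
isDerangement w = all (λ x → not (app w x ≡ᵇ x)) (fromTo 1 (length w))

-- w contains 3-12: indices i < j, j+1 ≤ n (1-indexed) with w_j < w_{j+1} < w_i.
-- Here 0-indexed: j ranges over 0..len-2, i over 0..j-1.
contains3-12 : List ℕ → Bool
contains3-12 w =
  any (λ j → any (λ i → (at w j <ᵇ at w (suc j)) ∧ (at w (suc j) <ᵇ at w i)) (upTo j))
      (upTo (length w ∸ 1))

inD3-12 : List ℕ → Bool
inD3-12 w = isDerangement w ∧ not (contains3-12 (flat w))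

headOr0 : List ℕ → ℕ
headOr0 []      = 0
headOr0 (x ∷ _) = x

lastOr0 : List ℕ → ℕ
lastOr0 []           = 0
lastOr0 (x ∷ [])     = x
lastOr0 (_ ∷ y ∷ ys) = lastOr0 (y ∷ ys)

lastCycle : List (List ℕ) → List ℕ
lastCycle []           = []
lastCycle (c ∷ [])     = c
lastCycle (_ ∷ d ∷ cs) = lastCycle (d ∷ cs)

-- Polynomials in y with ℕ coefficients, as coefficient sequences: p k = [y^k] p
Poly : Set
Poly = ℕ → ℕ

_≈P_ : Poly → Poly → Set
p ≈P q = ∀ k → p k ≡ q k
  where open import Relation.Binary.PropositionalEquality using (_≡_)

infixl 6 _+P_
infix 7 y*_
infix 4 _≈P_

_+P_ : Poly → Poly → Poly
(p +P q) k = p k + q k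

y*_ : Poly → Poly
(y* p) zero    = 0
(y* p) (suc k) = p k

yP : Poly
yP = y* (λ k → if k ≡ᵇ 0 then 1 else 0)

ΣP : ℕ → ℕ → (ℕ → Poly) → Poly
ΣP a b F k = sum (map (λ ℓ → F ℓ k) (fromTo a b))

-- z_n = Σ_{π ∈ D_{3-12}(n)} y^{μ(π)}   (for n = 1 this is 0 since D(1) = ∅)
z : ℕ → Poly
z n k = length (filterᵇ (λ w → inD3-12 w ∧ (μ w ≡ᵇ k)) (perms n))

zij : ℕ → ℕ → ℕ → Poly
zij n i j k = length (filterᵇ
  (λ w → inD3-12 w ∧ (μ w ≡ᵇ k)
         ∧ (headOr0 (lastCycle (cycles w)) ≡ᵇ i)
         ∧ (lastOr0 (lastCycle (cycles w)) ≡ᵇ j))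
  (perms n))

{-# OPTIONS --safe #-}
-- A permutation is determined by its standard cycle form, which is recovered by scanning 1, 2, …, n
-- and opening a new cycle at every point not yet visited. So z_{n,i,j} counts the cycle forms of [n]
-- whose cycles have length at least 2, whose flattened word avoids 3-12 and whose last cycle runs
-- from i to j, and each recurrence is a bijection that only changes the last cycle. Appending a
-- letter x to a word creates a 3-12 exactly when x exceeds the last letter and some earlier letter
-- exceeds x; in particular appending a new maximum is harmless.
--   j < n: drop j from the last cycle (i … ℓ j) and lower every letter above j by one. Here ℓ > j,
--          as otherwise n, ℓ, j would be an occurrence of 3-12, so the new last cycle ends in
--          ℓ - 1 ∈ [j, n - 1].
--   j = n: drop n from (i … ℓ n). If ℓ ≠ i the last cycle now ends in ℓ ∈ [i + 1, n - 1]; if the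
--          last cycle was (i n), it disappears (one cycle fewer: the factor y) and i is appended
--          to the cycle (ℓ …) before it, where ℓ < i.
--   (n-1 n) is the last cycle: remove it, leaving a cycle form of [n - 2] with one cycle fewer.
module Submission where

open import Defs
open import Data.Bool using (Bool; true; false; _∧_; not; T; if_then_else_)
open import Data.Bool.ListAction using (any)
open import Data.Bool.Properties using (T-∧; ∧-assoc; ∧-comm)
open import Data.Empty using (⊥; ⊥-elim)
open import Data.List using (List; []; _∷_; _++_; _∷ʳ_; length; map; concat; applyUpTo; upTo; filterᵇ; initLast; _∷ʳ′_)
import Data.List.Properties as List
open import Data.List.Membership.Propositional using (_∈_; _∉_; find; lose)
open import Data.List.Membership.Propositional.Properties
open import Data.List.Relation.Unary.All using (All; []; _∷_)
import Data.List.Relation.Unary.All as All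
import Data.List.Relation.Unary.All.Properties as All
open import Data.List.Relation.Unary.AllPairs using (AllPairs; []; _∷_)
import Data.List.Relation.Unary.AllPairs as AllPairs
import Data.List.Relation.Unary.AllPairs.Properties as AllPairs
open import Data.List.Relation.Unary.Any using (here; there)
import Data.List.Relation.Unary.Any as Any
import Data.List.Relation.Unary.Any.Properties as Any
open import Data.List.Relation.Unary.Unique.Propositional using (Unique)
import Data.List.Relation.Unary.Unique.Propositional.Properties as Unique
open import Data.Nat using (ℕ; zero; suc; _+_; _∸_; _≤_; _<_; z≤n; s≤s; _≡ᵇ_; _<ᵇ_; _≤ᵇ_)
open import Data.Nat.ListAction using (sum)
open import Data.Nat.Properties
open import Algebra.Properties.CommutativeSemigroup +-commutativeSemigroup using () renaming (interchange to +-interchange)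
open import Data.Product using (∃; ∃₂; _×_; _,_; proj₁; proj₂)
open import Data.Product.Function.NonDependent.Propositional using (_×-⇔_)
open import Data.Sum using (_⊎_; inj₁; inj₂; [_,_]′)
open import Function using (_∘_; _∋_; _⇔_; mk⇔; Equivalence; case_of_)
open import Function.Properties.Equivalence using () renaming (trans to ⇔-trans)
open import Relation.Binary.Definitions using (tri<; tri≈; tri>)
open import Relation.Binary.PropositionalEquality
open import Relation.Nullary using (¬_; Dec; yes; no)
open import Relation.Nullary.Decidable using (T?)
open import Relation.Unary using (_∪_; _∩_; ∁; ｛_｝; _≐_)

indicator : Bool → ℕ
indicator true  = 1
indicator false = 0

T-injective : ∀ {a b} → (T a → T b) → (T b → T a) → a ≡ b
T-injective {false} {false} _ _ = refl
T-injective {false} {true}  _ g = ⊥-elim (g _)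
T-injective {true}  {false} f _ = ⊥-elim (f _)
T-injective {true}  {true}  _ _ = refl

T-true : ∀ {a} → T a → a ≡ true
T-true {true} _ = refl

T-false : ∀ {a} → ¬ T a → a ≡ false
T-false {false} _ = refl
T-false {true}  f = ⊥-elim (f _)

T-not : ∀ {a} → ¬ T a → T (not a)
T-not {false} _ = _
T-not {true}  f = f _

T-not⁻ : ∀ {a} → T (not a) → ¬ T a
T-not⁻ {false} _ ()

T-∧⁺ : ∀ {a b} → T a → T b → T (a ∧ b)
T-∧⁺ p q = Equivalence.from T-∧ (p , q)

T-∧⁻ : ∀ {a b} → T (a ∧ b) → T a × T b
T-∧⁻ = Equivalence.to T-∧

≡ᵇ-refl : ∀ n → T (n ≡ᵇ n)
≡ᵇ-refl n = ≡⇒≡ᵇ n n refl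

≡ᵇ-false : ∀ {m n} → m ≢ n → (m ≡ᵇ n) ≡ false
≡ᵇ-false {m} {n} m≢n = T-false (m≢n ∘ ≡ᵇ⇒≡ m n)

∈⇒any-≡ᵇ : ∀ {x xs} → x ∈ xs → T (any (x ≡ᵇ_) xs)
∈⇒any-≡ᵇ {x} x∈ = Any.any⁺ (x ≡ᵇ_) (Any.map (λ { refl → ≡ᵇ-refl x }) x∈)

any-≡ᵇ⇒∈ : ∀ {x} xs → T (any (x ≡ᵇ_) xs) → x ∈ xs
any-≡ᵇ⇒∈ {x} xs t = Any.map (≡ᵇ⇒≡ x _) (Any.any⁻ (x ≡ᵇ_) xs t)

inRangeᵇ : ℕ → ℕ → ℕ → Bool
inRangeᵇ a b v = (a ≤ᵇ v) ∧ (v ≤ᵇ b)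

T-inRangeᵇ⁻ : ∀ {a b v} → T (inRangeᵇ a b v) → a ≤ v × v ≤ b
T-inRangeᵇ⁻ {a} {b} {v} t = ≤ᵇ⇒≤ a v (proj₁ (T-∧⁻ t)) , ≤ᵇ⇒≤ v b (proj₂ (T-∧⁻ {a ≤ᵇ v} t))

T-inRangeᵇ⁺ : ∀ {a b v} → a ≤ v → v ≤ b → T (inRangeᵇ a b v)
T-inRangeᵇ⁺ a≤v v≤b = T-∧⁺ (≤⇒≤ᵇ a≤v) (≤⇒≤ᵇ v≤b)

InRange : ℕ → ℕ → Set
InRange n v = 1 ≤ v × v ≤ n

applyUpTo-cong : ∀ {A : Set} {f g : ℕ → A} → (∀ i → f i ≡ g i) → ∀ n → applyUpTo f n ≡ applyUpTo g n
applyUpTo-cong eq zero    = refl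
applyUpTo-cong eq (suc n) = cong₂ _∷_ (eq 0) (applyUpTo-cong (eq ∘ suc) n)

fromTo-∈⁻ : ∀ {a b x} → x ∈ fromTo a b → a ≤ x × x ≤ b
fromTo-∈⁻ {a} {b} p with ∈-applyUpTo⁻ (a +_) p
... | i , i<len , refl = m≤m+n a i , ≤-pred (subst (_≤ suc b) (cong suc (+-comm i a)) (m≤o∸n⇒m+n≤o (suc i) a≤1+b i<len))
  where
  a≤1+b : a ≤ suc b
  a≤1+b = <⇒≤ (m∸n≢0⇒n<m (m<n⇒n≢0 i<len))

fromTo-∈⁺ : ∀ {a b x} → a ≤ x → x ≤ b → x ∈ fromTo a b
fromTo-∈⁺ {a} {b} {x} a≤x x≤b =
  subst (_∈ fromTo a b) (m+[n∸m]≡n a≤x) (∈-applyUpTo⁺ (a +_) (∸-monoˡ-< (s≤s x≤b) a≤x))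

fromTo-unique : ∀ a b → Unique (fromTo a b)
fromTo-unique a b = Unique.applyUpTo⁺₁ (a +_) (suc b ∸ a) (λ i<j _ eq → <⇒≢ i<j (+-cancelˡ-≡ a _ _ eq))

fromTo-length : ∀ a b → length (fromTo a b) ≡ suc b ∸ a
fromTo-length a b = List.length-applyUpTo (a +_) (suc b ∸ a)

fromTo-step : ∀ {a b} → a ≤ b → fromTo a b ≡ a ∷ fromTo (suc a) b
fromTo-step {a} {b} a≤b = begin
  applyUpTo (a +_) (suc b ∸ a)        ≡⟨ cong (applyUpTo (a +_)) (+-∸-assoc 1 a≤b) ⟩
  applyUpTo (a +_) (suc (b ∸ a))      ≡⟨ cong₂ _∷_ (+-identityʳ a) (applyUpTo-cong (+-suc a) (b ∸ a)) ⟩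
  a ∷ applyUpTo (suc a +_) (b ∸ a)    ∎
  where open ≡-Reasoning

fromTo-empty : ∀ {a b} → b < a → fromTo a b ≡ []
fromTo-empty {a} b<a = cong (applyUpTo (a +_)) (m≤n⇒m∸n≡0 b<a)

InRange⇒∈fromTo : ∀ {n x} → InRange n x → x ∈ fromTo 1 n
InRange⇒∈fromTo (1≤x , x≤n) = fromTo-∈⁺ 1≤x x≤n

at-∈ : ∀ (u : List ℕ) {k} → k < length u → at u k ∈ u
at-∈ (x ∷ u) {zero}  _         = here refl
at-∈ (x ∷ u) {suc k} (s≤s k<) = there (at-∈ u k<)

∈⇒at : ∀ {x} (u : List ℕ) → x ∈ u → ∃ λ k → k < length u × at u k ≡ x
∈⇒at (y ∷ u) (here refl) = 0 , s≤s z≤n , refl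
∈⇒at (y ∷ u) (there x∈) with ∈⇒at u x∈
... | k , k< , eq = suc k , s≤s k< , eq

at-injective : ∀ {u : List ℕ} → Unique u → ∀ {a b} → a < length u → b < length u → at u a ≡ at u b → a ≡ b
at-injective {x ∷ u} _          {zero}  {zero}  _        _        _  = refl
at-injective {x ∷ u} (x∉ ∷ _)   {zero}  {suc b} _        (s≤s b<) eq = ⊥-elim (All.lookup x∉ (at-∈ u b<) eq)
at-injective {x ∷ u} (x∉ ∷ _)   {suc a} {zero}  (s≤s a<) _        eq = ⊥-elim (All.lookup x∉ (at-∈ u a<) (sym eq))
at-injective {x ∷ u} (_ ∷ uniq) {suc a} {suc b} (s≤s a<) (s≤s b<) eq = cong suc (at-injective uniq a< b< eq)

at-++ˡ : ∀ (u v : List ℕ) {k} → k < length u → at (u ++ v) k ≡ at u k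
at-++ˡ (x ∷ u) v {zero}  _        = refl
at-++ˡ (x ∷ u) v {suc k} (s≤s k<) = at-++ˡ u v k<

at-∷ʳ-length : ∀ (u : List ℕ) x → at (u ∷ʳ x) (length u) ≡ x
at-∷ʳ-length []      x = refl
at-∷ʳ-length (y ∷ u) x = at-∷ʳ-length u x

length-∷ʳ : ∀ {A : Set} (xs : List A) x → length (xs ∷ʳ x) ≡ suc (length xs)
length-∷ʳ xs x = trans (List.length-++ xs) (+-comm (length xs) 1)

at-map : ∀ (f : ℕ → ℕ) (u : List ℕ) {k} → k < length u → at (map f u) k ≡ f (at u k)
at-map f (x ∷ u) {zero}  _        = refl
at-map f (x ∷ u) {suc k} (s≤s k<) = at-map f u k<

at-applyUpTo : ∀ (f : ℕ → ℕ) {n k} → k < n → at (applyUpTo f n) k ≡ f k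
at-applyUpTo f {suc n} {zero}  _        = refl
at-applyUpTo f {suc n} {suc k} (s≤s k<) = at-applyUpTo (f ∘ suc) k<

lastOr0≡at : ∀ (u : List ℕ) → lastOr0 u ≡ at u (length u ∸ 1)
lastOr0≡at []          = refl
lastOr0≡at (x ∷ [])    = refl
lastOr0≡at (x ∷ y ∷ u) = lastOr0≡at (y ∷ u)

map-app-fromTo : ∀ (w : List ℕ) → map (app w) (fromTo 1 (length w)) ≡ w
map-app-fromTo w = trans (List.map-applyUpTo (1 +_) (app w) (length w)) (applyUpTo-at w)
  where
  applyUpTo-at : ∀ (w : List ℕ) → applyUpTo (at w) (length w) ≡ w
  applyUpTo-at []      = refl
  applyUpTo-at (x ∷ w) = cong (x ∷_) (applyUpTo-at w)

Unique-++⁻ˡ : ∀ (xs : List ℕ) {ys} → Unique (xs ++ ys) → Unique xs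
Unique-++⁻ˡ []       _          = []
Unique-++⁻ˡ (x ∷ xs) (x∉ ∷ uniq) = All.++⁻ˡ xs x∉ ∷ Unique-++⁻ˡ xs uniq

Unique-++⁻ʳ : ∀ (xs : List ℕ) {ys} → Unique (xs ++ ys) → Unique ys
Unique-++⁻ʳ []       uniq       = uniq
Unique-++⁻ʳ (x ∷ xs) (_ ∷ uniq) = Unique-++⁻ʳ xs uniq

Unique-++⇒disjoint : ∀ (xs : List ℕ) {ys x} → Unique (xs ++ ys) → x ∈ xs → x ∉ ys
Unique-++⇒disjoint (a ∷ xs) (a∉ ∷ _)    (here refl) x∈ys = All.lookup (All.++⁻ʳ xs a∉) x∈ys refl
Unique-++⇒disjoint (a ∷ xs) (_ ∷ uniq) (there x∈)  x∈ys = Unique-++⇒disjoint xs uniq x∈ x∈ys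

Unique-∷ʳ : ∀ {u : List ℕ} {x} → Unique u → x ∉ u → Unique (u ∷ʳ x)
Unique-∷ʳ uniq x∉ = Unique.++⁺ uniq ([] ∷ []) (λ { (x∈ , here refl) → x∉ x∈ })

Unique-map-on : ∀ {A B : Set} (f : A → B) {xs : List A} → Unique xs →
  (∀ {a b} → a ∈ xs → b ∈ xs → f a ≡ f b → a ≡ b) → Unique (map f xs)
Unique-map-on f {[]}     []          inj = []
Unique-map-on f {x ∷ xs} (x∉ ∷ uniq) inj =
  All.map⁺ (All.tabulate (λ y∈ eq → All.lookup x∉ y∈ (inj (here refl) (there y∈) eq)))
  ∷ Unique-map-on f uniq (λ a∈ b∈ → inj (there a∈) (there b∈))

∈-remove : ∀ {A : Set} {x y : A} (as bs : List A) → y ∈ as ++ x ∷ bs → y ≢ x → y ∈ as ++ bs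
∈-remove []       bs (here refl) y≢x = ⊥-elim (y≢x refl)
∈-remove []       bs (there p)   _   = p
∈-remove (a ∷ as) bs (here refl) _   = here refl
∈-remove (a ∷ as) bs (there p)   y≢x = there (∈-remove as bs p y≢x)

Unique-⊆⇒length≤ : ∀ {A : Set} {xs ys : List A} → Unique xs → (∀ {v} → v ∈ xs → v ∈ ys) → length xs ≤ length ys
Unique-⊆⇒length≤ {xs = []}     _           _ = z≤n
Unique-⊆⇒length≤ {xs = x ∷ xs} (x∉ ∷ uniq) sub with ∈-∃++ (sub (here refl))
... | as , bs , refl = subst (suc (length xs) ≤_) (sym (List.length-++-sucʳ as x bs))
  (s≤s (Unique-⊆⇒length≤ uniq (λ v∈ → ∈-remove as bs (sub (there v∈)) (λ eq → All.lookup x∉ v∈ (sym eq)))))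

Unique-insert : ∀ (as bs : List ℕ) {x} → Unique (as ++ bs) → x ∉ as ++ bs → Unique (as ++ x ∷ bs)
Unique-insert []       bs uniq        x∉ = All.tabulate (λ y∈ eq → x∉ (subst (_∈ bs) (sym eq) y∈)) ∷ uniq
Unique-insert (a ∷ as) bs (a∉ ∷ uniq) x∉ =
  All.++⁺ (All.++⁻ˡ as a∉) ((λ eq → x∉ (here (sym eq))) ∷ All.++⁻ʳ as a∉)
  ∷ Unique-insert as bs uniq (x∉ ∘ there)

Unique-⊆-length≤ : ∀ {xs ys : List ℕ} → Unique xs → (∀ {v} → v ∈ xs → v ∈ ys) → length ys ≤ length xs →
  Unique ys × (∀ {v} → v ∈ ys → v ∈ xs)
Unique-⊆-length≤ {[]}     {[]}    _           _   _  = [] , λ ()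
Unique-⊆-length≤ {x ∷ xs} {ys}    (x∉ ∷ uniq) sub le with ∈-∃++ (sub (here refl))
... | as , bs , refl with Unique-⊆-length≤ {xs} {as ++ bs} uniq
      (λ v∈ → ∈-remove as bs (sub (there v∈)) (λ eq → All.lookup x∉ v∈ (sym eq)))
      (≤-pred (subst (_≤ suc (length xs)) (List.length-++-sucʳ as x bs) le))
...   | uniq′ , sub′ = Unique-insert as bs uniq′ (λ p → All.lookup x∉ (sub′ p) refl) , back
  where
  back : ∀ {v} → v ∈ as ++ x ∷ bs → v ∈ x ∷ xs
  back {v} p with v ≟ x
  ... | yes refl = here refl
  ... | no v≢x   = there (sub′ (∈-remove as bs p v≢x))

count : ∀ {A : Set} → (A → Bool) → List A → ℕ
count p xs = length (filterᵇ p xs)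

sum-map-zero : ∀ (R : List ℕ) → sum (map (λ _ → 0) R) ≡ 0
sum-map-zero []      = refl
sum-map-zero (_ ∷ R) = sum-map-zero R

sum-map-+ : ∀ (f g : ℕ → ℕ) R → sum (map (λ ℓ → f ℓ + g ℓ) R) ≡ sum (map f R) + sum (map g R)
sum-map-+ f g []      = refl
sum-map-+ f g (ℓ ∷ R) = trans (cong (f ℓ + g ℓ +_) (sum-map-+ f g R)) (+-interchange (f ℓ) (g ℓ) _ _)

sum-map-cong : ∀ {f g : ℕ → ℕ} R → (∀ ℓ → f ℓ ≡ g ℓ) → sum (map f R) ≡ sum (map g R)
sum-map-cong []      eq = refl
sum-map-cong (ℓ ∷ R) eq = cong₂ _+_ (eq ℓ) (sum-map-cong R eq)

module _ {A : Set} where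

  count-∷ : ∀ (p : A → Bool) x xs → count p (x ∷ xs) ≡ indicator (p x) + count p xs
  count-∷ p x xs with p x
  ... | true  = refl
  ... | false = refl

  count-cong : ∀ (p q : A → Bool) xs → (∀ {x} → x ∈ xs → p x ≡ q x) → count p xs ≡ count q xs
  count-cong p q []       eq = refl
  count-cong p q (x ∷ xs) eq = begin
    count p (x ∷ xs)                  ≡⟨ count-∷ p x xs ⟩
    indicator (p x) + count p xs      ≡⟨ cong₂ _+_ (cong indicator (eq (here refl))) (count-cong p q xs (eq ∘ there)) ⟩
    indicator (q x) + count q xs      ≡⟨ count-∷ q x xs ⟨
    count q (x ∷ xs)                  ∎
    where open ≡-Reasoning

  count-none : ∀ (p : A → Bool) xs → (∀ {x} → x ∈ xs → ¬ T (p x)) → count p xs ≡ 0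
  count-none p xs none = trans (count-cong p (λ _ → false) xs (T-false ∘ none)) (zero-count xs)
    where
    zero-count : ∀ xs → count (λ _ → false) xs ≡ 0
    zero-count []       = refl
    zero-count (_ ∷ xs) = zero-count xs

  count-split : ∀ (p q : A → Bool) xs →
    count p xs ≡ count (λ x → p x ∧ q x) xs + count (λ x → p x ∧ not (q x)) xs
  count-split p q []       = refl
  count-split p q (x ∷ xs) = begin
    count p (x ∷ xs)
      ≡⟨ count-∷ p x xs ⟩
    indicator (p x) + count p xs
      ≡⟨ cong₂ _+_ (indicator-split (p x) (q x)) (count-split p q xs) ⟩
    (indicator (p x ∧ q x) + indicator (p x ∧ not (q x))) + (count pq xs + count pq̅ xs)
      ≡⟨ +-interchange (indicator (p x ∧ q x)) _ _ _ ⟩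
    (indicator (p x ∧ q x) + count pq xs) + (indicator (p x ∧ not (q x)) + count pq̅ xs)
      ≡⟨ cong₂ _+_ (count-∷ pq x xs) (count-∷ pq̅ x xs) ⟨
    count pq (x ∷ xs) + count pq̅ (x ∷ xs)
      ∎
    where
    open ≡-Reasoning
    pq pq̅ : A → Bool
    pq  x = p x ∧ q x
    pq̅ x = p x ∧ not (q x)
    indicator-split : ∀ a b → indicator a ≡ indicator (a ∧ b) + indicator (a ∧ not b)
    indicator-split true  true  = refl
    indicator-split true  false = refl
    indicator-split false _     = refl

  sum-count : ∀ (R : List ℕ) (p : ℕ → A → Bool) (q : A → Bool) xs →
    (∀ {x} → x ∈ xs → sum (map (λ ℓ → indicator (p ℓ x)) R) ≡ indicator (q x)) →
    sum (map (λ ℓ → count (p ℓ) xs) R) ≡ count q xs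
  sum-count R p q []       _  = sum-map-zero R
  sum-count R p q (x ∷ xs) eq = begin
    sum (map (λ ℓ → count (p ℓ) (x ∷ xs)) R)
      ≡⟨ sum-map-cong R (λ ℓ → count-∷ (p ℓ) x xs) ⟩
    sum (map (λ ℓ → indicator (p ℓ x) + count (p ℓ) xs) R)
      ≡⟨ sum-map-+ (λ ℓ → indicator (p ℓ x)) (λ ℓ → count (p ℓ) xs) R ⟩
    sum (map (λ ℓ → indicator (p ℓ x)) R) + sum (map (λ ℓ → count (p ℓ) xs) R)
      ≡⟨ cong₂ _+_ (eq (here refl)) (sum-count R p q xs (eq ∘ there)) ⟩
    indicator (q x) + count q xs
      ≡⟨ count-∷ q x xs ⟨
    count q (x ∷ xs)
      ∎
    where open ≡-Reasoning

  count-≤-by-injection : ∀ {B : Set} {xs : List A} {ys : List B} {p : A → Bool} {q : B → Bool}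
    (f : A → B) (g : B → A) → Unique xs →
    (∀ {x} → x ∈ xs → T (p x) → f x ∈ ys × T (q (f x)) × g (f x) ≡ x) →
    count p xs ≤ count q ys
  count-≤-by-injection {xs = xs} {ys} {p} {q} f g uniq to =
    subst (_≤ count q ys) (List.length-map f (filterᵇ p xs))
      (Unique-⊆⇒length≤ (Unique-map-on f (Unique.filter⁺ (T? ∘ p) uniq) injective) image⊆)
    where
    injective : ∀ {a b} → a ∈ filterᵇ p xs → b ∈ filterᵇ p xs → f a ≡ f b → a ≡ b
    injective a∈ b∈ eq with ∈-filter⁻ (T? ∘ p) {xs = xs} a∈ | ∈-filter⁻ (T? ∘ p) {xs = xs} b∈
    ... | a∈′ , pa | b∈′ , pb =
      trans (sym (proj₂ (proj₂ (to a∈′ pa)))) (trans (cong g eq) (proj₂ (proj₂ (to b∈′ pb))))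
    image⊆ : ∀ {v} → v ∈ map f (filterᵇ p xs) → v ∈ filterᵇ q ys
    image⊆ v∈ with ∈-map⁻ f v∈
    ... | x , x∈ , refl with ∈-filter⁻ (T? ∘ p) {xs = xs} x∈
    ...   | x∈′ , px = ∈-filter⁺ (T? ∘ q) (proj₁ (to x∈′ px)) (proj₁ (proj₂ (to x∈′ px)))

count-by-bijection : ∀ {A B : Set} {xs : List A} {ys : List B} {p : A → Bool} {q : B → Bool}
  (f : A → B) (g : B → A) → Unique xs → Unique ys →
  (∀ {x} → x ∈ xs → T (p x) → f x ∈ ys × T (q (f x)) × g (f x) ≡ x) →
  (∀ {y} → y ∈ ys → T (q y) → g y ∈ xs × T (p (g y)) × f (g y) ≡ y) →
  count p xs ≡ count q ys
count-by-bijection f g uniqˣ uniqʸ to from =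
  ≤-antisym (count-≤-by-injection f g uniqˣ to) (count-≤-by-injection g f uniqʸ from)

sum-indicator-≡ᵇ : ∀ v (R : List ℕ) → Unique R → sum (map (λ ℓ → indicator (v ≡ᵇ ℓ)) R) ≡ indicator (any (v ≡ᵇ_) R)
sum-indicator-≡ᵇ v []      _            = refl
sum-indicator-≡ᵇ v (ℓ ∷ R) (ℓ∉ ∷ uniq) with v ≟ ℓ
... | no v≢ℓ   rewrite ≡ᵇ-false v≢ℓ = sum-indicator-≡ᵇ v R uniq
... | yes refl rewrite T-true (≡ᵇ-refl v) =
  cong suc (trans (sum-indicator-≡ᵇ v R uniq) (cong indicator (T-false (λ t → All.lookup ℓ∉ (any-≡ᵇ⇒∈ R t) refl))))

any-≡ᵇ-fromTo : ∀ a b v → any (v ≡ᵇ_) (fromTo a b) ≡ inRangeᵇ a b v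
any-≡ᵇ-fromTo a b v = T-injective
  (λ t → let a≤v , v≤b = fromTo-∈⁻ (any-≡ᵇ⇒∈ (fromTo a b) t) in T-inRangeᵇ⁺ a≤v v≤b)
  (λ t → let a≤v , v≤b = T-inRangeᵇ⁻ {a} {b} {v} t in ∈⇒any-≡ᵇ (fromTo-∈⁺ {a} {b} a≤v v≤b))

sum-count-fromTo : ∀ {A : Set} (p : A → Bool) (v : A → ℕ) a b xs →
  sum (map (λ ℓ → count (λ x → p x ∧ (v x ≡ᵇ ℓ)) xs) (fromTo a b)) ≡ count (λ x → p x ∧ inRangeᵇ a b (v x)) xs
sum-count-fromTo p v a b xs = sum-count (fromTo a b) _ _ xs (λ {x} _ → pointwise (p x) (v x))
  where
  pointwise : ∀ c v → sum (map (λ ℓ → indicator (c ∧ (v ≡ᵇ ℓ))) (fromTo a b)) ≡ indicator (c ∧ inRangeᵇ a b v)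
  pointwise false v = sum-map-zero (fromTo a b)
  pointwise true  v = trans (sum-indicator-≡ᵇ v (fromTo a b) (fromTo-unique a b)) (cong indicator (any-≡ᵇ-fromTo a b v))

-- Permutations and their cycles

record Perm (n : ℕ) (w : List ℕ) : Set where
  constructor mkPerm
  field
    length≡n         : length w ≡ n
    entries-in-range : All (InRange n) w
    entries-unique   : Unique w
open Perm public

distinct⇔Unique : ∀ w → T (distinct w) ⇔ Unique w
distinct⇔Unique w = mk⇔ (to w) (from w)
  where
  to : ∀ w → T (distinct w) → Unique w
  to []      _ = []
  to (x ∷ w) t = let x∉ , rest = T-∧⁻ t in
    All.tabulate (λ y∈ eq → T-not⁻ x∉ (∈⇒any-≡ᵇ (subst (_∈ w) (sym eq) y∈))) ∷ to w rest
  from : ∀ w → Unique w → T (distinct w)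
  from []      _           = _
  from (x ∷ w) (x∉ ∷ uniq) = T-∧⁺ (T-not (λ t → All.lookup x∉ (any-≡ᵇ⇒∈ w t) refl)) (from w uniq)

words-∈⁻ : ∀ m k {w} → w ∈ words m k → length w ≡ k × All (InRange m) w
words-∈⁻ m zero    (here refl) = refl , []
words-∈⁻ m (suc k) p with find (∈-concatMap⁻ (λ a → map (a ∷_) (words m k)) {xs = fromTo 1 m} p)
... | a , a∈ , w∈ with ∈-map⁻ (a ∷_) w∈
...   | w′ , w′∈ , refl = let len , rng = words-∈⁻ m k w′∈ in cong suc len , fromTo-∈⁻ a∈ ∷ rng

words-∈⁺ : ∀ m k {w} → length w ≡ k → All (InRange m) w → w ∈ words m k
words-∈⁺ m zero    {[]}    refl []              = here refl
words-∈⁺ m (suc k) {a ∷ w} len  (a∈ ∷ rng) =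
  ∈-concatMap⁺ (λ a → map (a ∷_) (words m k)) {xs = fromTo 1 m}
    (Any.map (λ { refl → ∈-map⁺ (a ∷_) (words-∈⁺ m k (suc-injective len) rng) }) (InRange⇒∈fromTo a∈))

words-unique : ∀ m k → Unique (words m k)
words-unique m zero    = [] ∷ []
words-unique m (suc k) = Unique.concat⁺
  (All.map⁺ (All.tabulate (λ _ → Unique.map⁺ List.∷-injectiveʳ (words-unique m k))))
  (AllPairs.map⁺ (AllPairs.map (λ a≢b {v} → disjoint {v = v} a≢b) (fromTo-unique 1 m)))
  where
  disjoint : ∀ {a b v} → a ≢ b → ¬ (v ∈ map (a ∷_) (words m k) × v ∈ map (b ∷_) (words m k))
  disjoint a≢b (p , q) with ∈-map⁻ _ p | ∈-map⁻ _ q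
  ... | _ , _ , refl | _ , _ , eq = a≢b (List.∷-injectiveˡ eq)

perms-∈⁻ : ∀ {n w} → w ∈ perms n → Perm n w
perms-∈⁻ {n} {w} p with ∈-filter⁻ (T? ∘ distinct) {xs = words n n} p
... | w∈ , d = let len , rng = words-∈⁻ n n w∈ in mkPerm len rng (Equivalence.to (distinct⇔Unique w) d)

perms-∈⁺ : ∀ {n w} → Perm n w → w ∈ perms n
perms-∈⁺ {n} {w} (mkPerm len rng uniq) =
  ∈-filter⁺ (T? ∘ distinct) (words-∈⁺ n n len rng) (Equivalence.from (distinct⇔Unique w) uniq)

perms-unique : ∀ n → Unique (perms n)
perms-unique n = Unique.filter⁺ (T? ∘ distinct) (words-unique n n)

-- The helpers  go  local to Defs.cycles and Defs.cycleFrom cannot be referred to by name.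
-- Each is bound here to a metavariable that unification solves from the with-abstracted goal.
mutual
  scan : List ℕ → List ℕ → List ℕ → List (List ℕ)
  scan = _

  private
    scan-probe : (w : List ℕ) → cycles w ≡ cycles w
    scan-probe w with length w
    ... | m with applyUpTo (_+_ 1) m
    ... | [] = refl
    ... | i ∷ is with cycleFrom w i ++ []
    ... | vis = cong (cycleFrom w i ∷_) ((scan w is vis ≡ scan w is vis) ∋ refl)

mutual
  follow : List ℕ → ℕ → ℕ → ℕ → List ℕ
  follow = _

  private
    follow-probe : (w : List ℕ) (s : ℕ) → cycleFrom w s ≡ cycleFrom w s
    follow-probe w s with length w
    ... | f with app w s
    ... | x = (s ∷ follow w s f x ≡ s ∷ follow w s f x) ∋ refl

app-inRange : ∀ {n w x} → Perm n w → InRange n x → InRange n (app w x)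
app-inRange {w = w} {suc x} P (_ , x≤n) =
  All.lookup (entries-in-range P) (at-∈ w (subst (x <_) (sym (length≡n P)) x≤n))

app-injective : ∀ {n w x y} → Perm n w → InRange n x → InRange n y → app w x ≡ app w y → x ≡ y
app-injective {w = w} {suc x} {suc y} P (_ , x≤n) (_ , y≤n) eq =
  cong suc (at-injective (entries-unique P) (subst (x <_) (sym (length≡n P)) x≤n) (subst (y <_) (sym (length≡n P)) y≤n) eq)

iterate : (ℕ → ℕ) → ℕ → ℕ → ℕ
iterate σ zero    x = x
iterate σ (suc k) x = σ (iterate σ k x)

module _ {n w} (P : Perm n w) where

  iterate-inRange : ∀ {x} → InRange n x → ∀ k → InRange n (iterate (app w) k x)
  iterate-inRange x∈ zero    = x∈
  iterate-inRange x∈ (suc k) = app-inRange P (iterate-inRange x∈ k)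

  iterate-cancel : ∀ {s} → InRange n s → ∀ a b → a ≤ b →
    iterate (app w) a s ≡ iterate (app w) b s → s ≡ iterate (app w) (b ∸ a) s
  iterate-cancel s∈ zero    b       _         eq = eq
  iterate-cancel s∈ (suc a) (suc b) (s≤s a≤b) eq =
    iterate-cancel s∈ a b a≤b (app-injective P (iterate-inRange s∈ a) (iterate-inRange s∈ b) eq)

first-satisfying : (Q : ℕ → Set) → (∀ k → Dec (Q k)) → ∀ m →
  (∀ k → k < m → ¬ Q k) ⊎ ∃ λ k → k < m × Q k × (∀ j → j < k → ¬ Q j)
first-satisfying Q Q? zero = inj₁ (λ _ ())
first-satisfying Q Q? (suc m) with first-satisfying Q Q? m
... | inj₂ (k , k<m , qk , before) = inj₂ (k , m<n⇒m<1+n k<m , qk , before)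
... | inj₁ none with Q? m
...   | yes qm = inj₂ (m , ≤-refl , qm , none)
...   | no ¬qm = inj₁ λ k k<1+m → [ none k , (λ { refl → ¬qm }) ]′ (m<1+n⇒m<n∨m≡n k<1+m)

record Period (σ : ℕ → ℕ) (s n : ℕ) : Set where
  constructor mkPeriod
  field
    period      : ℕ
    period≥1    : 1 ≤ period
    period≤n    : period ≤ n
    returns     : iterate σ period s ≡ s
    minimal     : ∀ j → 1 ≤ j → j < period → iterate σ j s ≢ s
open Period public

-- The orbit of s has at most n distinct points, so it returns to s within n steps.
period-exists : ∀ {n w s} → Perm n w → InRange n s → Period (app w) s n
period-exists {n} {w} {s} P s∈
  with first-satisfying (λ k → iterate (app w) (suc k) s ≡ s) (λ k → iterate (app w) (suc k) s ≟ s) n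
... | inj₂ (k , k<n , returns , before) =
  mkPeriod (suc k) (s≤s z≤n) k<n returns (λ { (suc j) _ (s≤s j<k) → before j j<k })
... | inj₁ never = ⊥-elim (<-irrefl refl (≤-trans too-long (≤-reflexive (fromTo-length 1 n))))
  where
  orbit : List ℕ
  orbit = applyUpTo (λ k → iterate (app w) k s) (suc n)
  orbit-unique : Unique orbit
  orbit-unique = Unique.applyUpTo⁺₁ (λ k → iterate (app w) k s) (suc n) distinct-points
    where
    distinct-points : ∀ {i j} → i < j → j < suc n → iterate (app w) i s ≢ iterate (app w) j s
    distinct-points {i} {j} i<j j≤n eq =
      never (j ∸ suc i) (≤-trans (≤-reflexive (sym gap)) (≤-trans (m∸n≤m j i) (≤-pred j≤n)))
        (trans (cong (λ t → iterate (app w) t s) (sym gap)) (sym (iterate-cancel P s∈ i j (<⇒≤ i<j) eq)))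
      where
      gap : j ∸ i ≡ suc (j ∸ suc i)
      gap = +-∸-assoc 1 i<j
  too-long : suc n ≤ length (fromTo 1 n)
  too-long = subst (_≤ length (fromTo 1 n)) (List.length-applyUpTo (λ k → iterate (app w) k s) (suc n))
    (Unique-⊆⇒length≤ orbit-unique λ v∈ → let k , _ , v≡ = ∈-applyUpTo⁻ (λ k → iterate (app w) k s) v∈ in
      subst (_∈ fromTo 1 n) (sym v≡) (InRange⇒∈fromTo (iterate-inRange P s∈ k)))

-- Starting at x, σ visits exactly the entries of t and then arrives at h.
PathTo : (ℕ → ℕ) → ℕ → ℕ → List ℕ → Set
PathTo σ h x []      = x ≡ h
PathTo σ h x (y ∷ t) = x ≡ y × PathTo σ h (σ y) t

IsCycle : (ℕ → ℕ) → List ℕ → Set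
IsCycle σ []      = ⊥
IsCycle σ (h ∷ t) = PathTo σ h (σ h) t

segment : (ℕ → ℕ) → ℕ → ℕ → ℕ → List ℕ
segment σ s j m = applyUpTo (λ i → iterate σ (j + i) s) m

segment-suc : ∀ σ s j m → segment σ s j (suc m) ≡ iterate σ j s ∷ segment σ s (suc j) m
segment-suc σ s j m = cong₂ _∷_ (cong (λ t → iterate σ t s) (+-identityʳ j))
  (applyUpTo-cong (λ i → cong (λ t → iterate σ t s) (+-suc j i)) m)

record CycleThrough (n : ℕ) (σ : ℕ → ℕ) (s : ℕ) (c : List ℕ) : Set where
  field
    cycle    : IsCycle σ c
    unique   : Unique c
    inRange  : All (InRange n) c
    starts   : ∃ λ t → c ≡ s ∷ t

module _ {n w s} (P : Perm n w) (s∈ : InRange n s) (p : Period (app w) s n) where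
  private
    σ : ℕ → ℕ
    σ = app w

    follow-segment : ∀ m j → 1 ≤ j → j + m ≡ period p → ∀ f → m ≤ f →
      follow w s f (iterate σ j s) ≡ segment σ s j m
    follow-segment zero j _ j≡p f _
      rewrite trans (cong (λ t → iterate σ t s) (trans (sym (+-identityʳ j)) j≡p)) (returns p) with f
    ... | zero   = refl
    ... | suc f′ rewrite T-true (≡ᵇ-refl s) = refl
    follow-segment (suc m) j 1≤j j+m≡p (suc f) (s≤s m≤f) = begin
      follow w s (suc f) (iterate σ j s)
        ≡⟨ cong (λ b → if b then [] else iterate σ j s ∷ follow w s f (iterate σ (suc j) s)) (≡ᵇ-false not-back) ⟩
      iterate σ j s ∷ follow w s f (iterate σ (suc j) s)
        ≡⟨ cong (iterate σ j s ∷_) (follow-segment m (suc j) (s≤s z≤n) (trans (sym (+-suc j m)) j+m≡p) f m≤f) ⟩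
      iterate σ j s ∷ segment σ s (suc j) m
        ≡⟨ segment-suc σ s j m ⟨
      segment σ s j (suc m) ∎
      where
      open ≡-Reasoning
      not-back : iterate σ j s ≢ s
      not-back = minimal p j 1≤j (subst (j <_) j+m≡p (m<m+n j (s≤s z≤n)))

    segment-path : ∀ m j → j + m ≡ period p → PathTo σ s (iterate σ j s) (segment σ s j m)
    segment-path zero    j j≡p =
      trans (cong (λ t → iterate σ t s) (trans (sym (+-identityʳ j)) j≡p)) (returns p)
    segment-path (suc m) j j+m≡p = subst (PathTo σ s (iterate σ j s)) (sym (segment-suc σ s j m))
      (refl , segment-path m (suc j) (trans (sym (+-suc j m)) j+m≡p))

    period≡1+ : 1 + (period p ∸ 1) ≡ period p
    period≡1+ = m+[n∸m]≡n (period≥1 p)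

    orbit≡ : segment σ s 0 (period p) ≡ s ∷ segment σ s 1 (period p ∸ 1)
    orbit≡ = trans (cong (segment σ s 0) (sym period≡1+)) (segment-suc σ s 0 (period p ∸ 1))

  cycleFrom≡segment : cycleFrom w s ≡ segment σ s 0 (period p)
  cycleFrom≡segment = trans (cong (s ∷_) (follow-segment (period p ∸ 1) 1 ≤-refl period≡1+ (length w)
      (≤-trans (m∸n≤m (period p) 1) (subst (period p ≤_) (sym (length≡n P)) (period≤n p)))))
    (sym orbit≡)

  segment-cycleThrough : CycleThrough n σ s (segment σ s 0 (period p))
  segment-cycleThrough = record
    { cycle   = subst (IsCycle σ) (sym orbit≡) (segment-path (period p ∸ 1) 1 period≡1+)
    ; unique  = Unique.applyUpTo⁺₁ (λ i → iterate σ i s) (period p) distinct-points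
    ; inRange = All.tabulate λ v∈ → let i , _ , v≡ = ∈-applyUpTo⁻ (λ i → iterate σ i s) v∈ in
                  subst (InRange n) (sym v≡) (iterate-inRange P s∈ i)
    ; starts  = _ , orbit≡
    }
    where
    distinct-points : ∀ {i j} → i < j → j < period p → iterate σ i s ≢ iterate σ j s
    distinct-points {i} {j} i<j j<p eq = minimal p (j ∸ i) (m<n⇒0<n∸m i<j) (≤-<-trans (m∸n≤m j i) j<p)
      (sym (iterate-cancel P s∈ i j (<⇒≤ i<j) eq))

cycleFrom-cycleThrough : ∀ {n w s} → Perm n w → InRange n s → CycleThrough n (app w) s (cycleFrom w s)
cycleFrom-cycleThrough {n} {w} {s} P s∈ = subst (CycleThrough n (app w) s) (sym (cycleFrom≡segment P s∈ p))
  (segment-cycleThrough P s∈ p)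
  where
  p = period-exists P s∈

PathTo-start : ∀ {σ h x} t → PathTo σ h x t → x ∈ t ⊎ x ≡ h
PathTo-start []      x≡h     = inj₂ x≡h
PathTo-start (y ∷ t) (x≡y , _) = inj₁ (here x≡y)

PathTo-closed : ∀ {σ h z x} t → PathTo σ h z t → x ∈ t → σ x ∈ t ⊎ σ x ≡ h
PathTo-closed (y ∷ t) (_ , path) (here refl) with PathTo-start t path
... | inj₁ p = inj₁ (there p)
... | inj₂ e = inj₂ e
PathTo-closed (y ∷ t) (_ , path) (there x∈) with PathTo-closed t path x∈
... | inj₁ p = inj₁ (there p)
... | inj₂ e = inj₂ e

IsCycle-closed : ∀ {σ x} c → IsCycle σ c → x ∈ c → σ x ∈ c
IsCycle-closed (h ∷ t) path x∈ with x∈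
... | here refl with PathTo-start t path
...   | inj₁ p = there p
...   | inj₂ e = here e
IsCycle-closed (h ∷ t) path x∈ | there x∈t with PathTo-closed t path x∈t
...   | inj₁ p = there p
...   | inj₂ e = here e

PathTo-reaches : ∀ {σ h z} (V : ℕ → Set) → (∀ {x} → V x → V (σ x)) → ∀ t → PathTo σ h z t → V z → V h
PathTo-reaches V closed []      z≡h        vz = subst V z≡h vz
PathTo-reaches V closed (y ∷ t) (z≡y , path) vz = PathTo-reaches V closed t path (closed (subst V z≡y vz))

IsCycle-reaches : ∀ {σ x} (V : ℕ → Set) → (∀ {x} → V x → V (σ x)) → ∀ c → IsCycle σ c → x ∈ c → V x → V (headOr0 c)
IsCycle-reaches V closed (h ∷ t) path (here refl) vx = vx
IsCycle-reaches V closed (h ∷ t) path (there x∈) vx = go t path x∈ vx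
  where
  go : ∀ {z x} t → PathTo _ _ z t → x ∈ t → V x → V _
  go (y ∷ t) (_ , path) (here refl) vx = PathTo-reaches V closed t path (closed vx)
  go (y ∷ t) (_ , path) (there x∈)  vx = go t path x∈ vx

-- Standard cycle forms

-- Standard cycle forms of permutations of an arbitrary set S rather than [n], so that the
-- bijections below can add and remove single values one at a time.
record StandardForm (S : ℕ → Set) (cs : List (List ℕ)) : Set where
  constructor mkStandardForm
  field
    nonempty         : All (λ c → 1 ≤ length c) cs
    flat-unique      : Unique (concat cs)
    flat-sound       : All S (concat cs)
    flat-complete    : ∀ {x} → S x → x ∈ concat cs
    head-minimal     : All (λ c → All (headOr0 c ≤_) c) cs
    heads-increasing : AllPairs _<_ (map headOr0 cs)
open StandardForm public

CycleForm : ℕ → List ℕ → List (List ℕ) → Set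
CycleForm n w cs = StandardForm (InRange n) cs × All (IsCycle (app w)) cs

record ScanOutput (n : ℕ) (σ : ℕ → ℕ) (i : ℕ) (vis : List ℕ) (out : List (List ℕ)) : Set where
  constructor mkScanOutput
  field
    out-cycles           : All (IsCycle σ) out
    out-nonempty         : All (λ c → 1 ≤ length c) out
    out-unique           : Unique (concat out)
    out-fresh            : ∀ {x} → x ∈ concat out → x ∉ vis
    out-sound            : All (InRange n) (concat out)
    out-complete         : ∀ {x} → InRange n x → x ∈ vis ⊎ x ∈ concat out
    out-head-minimal     : All (λ c → All (headOr0 c ≤_) c) out
    out-heads-increasing : AllPairs _<_ (map headOr0 out)
    out-heads-≥          : All (λ c → i ≤ headOr0 c) out
open ScanOutput

+suc≡⇒≤ : ∀ i m n → i + suc m ≡ suc n → i ≤ n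
+suc≡⇒≤ i m n eq = ≤-pred (subst (i <_) eq (m<m+n i (s≤s z≤n)))

scan-output : ∀ {n w} → Perm n w → ∀ m i vis → i + m ≡ suc n → 1 ≤ i →
  (∀ {x} → x ∈ vis → app w x ∈ vis) → (∀ {x} → InRange n x → x < i → x ∈ vis) → All (InRange n) vis →
  ScanOutput n (app w) i vis (scan w (fromTo i n) vis)
scan-output {n} {w} P zero i vis i≡1+n _ _ below _
  rewrite trans (sym (+-identityʳ i)) i≡1+n | fromTo-empty {suc n} {n} ≤-refl =
  mkScanOutput [] [] [] (λ ()) [] (λ x∈ → inj₁ (below x∈ (s≤s (proj₂ x∈)))) [] [] []
scan-output {n} {w} P (suc m) i vis eq 1≤i closed below vis-inRange
  rewrite fromTo-step (+suc≡⇒≤ i m n eq) with T? (any (i ≡ᵇ_) vis)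
... | yes i∈vis rewrite T-true i∈vis = weaken (scan-output P m (suc i) vis (trans (sym (+-suc i m)) eq) (s≤s z≤n)
      closed below′ vis-inRange)
  where
  below′ : ∀ {x} → InRange n x → x < suc i → x ∈ vis
  below′ x∈ x<1+i with m<1+n⇒m<n∨m≡n x<1+i
  ... | inj₁ x<i  = below x∈ x<i
  ... | inj₂ refl = any-≡ᵇ⇒∈ vis i∈vis
  weaken : ∀ {out} → ScanOutput n (app w) (suc i) vis out → ScanOutput n (app w) i vis out
  weaken (mkScanOutput a b c d e f g h k) = mkScanOutput a b c d e f g h (All.map (≤-trans (n≤1+n i)) k)
... | no i∉vis rewrite T-false i∉vis =
  mkScanOutput (cycle C ∷ out-cycles IH)
    (subst (λ l → 1 ≤ length l) (sym c≡) (s≤s z≤n) ∷ out-nonempty IH)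
    (Unique.++⁺ (unique C) (out-unique IH) (λ (p , q) → out-fresh IH q (∈-++⁺ˡ p)))
    fresh′
    (All.++⁺ (inRange C) (out-sound IH))
    complete′
    (All.tabulate head-below ∷ out-head-minimal IH)
    (All.map⁺ (All.map (λ le → subst (_< _) (sym head≡i) le) (out-heads-≥ IH)) ∷ out-heads-increasing IH)
    (≤-reflexive (sym head≡i) ∷ All.map (≤-trans (n≤1+n i)) (out-heads-≥ IH))
  where
  open CycleThrough
  c : List ℕ
  c = cycleFrom w i
  C : CycleThrough n (app w) i c
  C = cycleFrom-cycleThrough P (1≤i , +suc≡⇒≤ i m n eq)
  c≡ : c ≡ i ∷ proj₁ (starts C)
  c≡ = proj₂ (starts C)
  head≡i : headOr0 c ≡ i
  head≡i = cong headOr0 c≡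
  c∩vis : ∀ {y} → y ∈ c → y ∉ vis
  c∩vis y∈c y∈vis = i∉vis (∈⇒any-≡ᵇ (subst (_∈ vis) head≡i (IsCycle-reaches (_∈ vis) closed c (cycle C) y∈c y∈vis)))
  closed′ : ∀ {x} → x ∈ c ++ vis → app w x ∈ c ++ vis
  closed′ p with ∈-++⁻ c p
  ... | inj₁ q = ∈-++⁺ˡ (IsCycle-closed c (cycle C) q)
  ... | inj₂ q = ∈-++⁺ʳ c (closed q)
  below′ : ∀ {x} → InRange n x → x < suc i → x ∈ c ++ vis
  below′ x∈ x<1+i with m<1+n⇒m<n∨m≡n x<1+i
  ... | inj₁ x<i  = ∈-++⁺ʳ c (below x∈ x<i)
  ... | inj₂ refl = ∈-++⁺ˡ (subst (i ∈_) (sym c≡) (here refl))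
  IH : ScanOutput n (app w) (suc i) (c ++ vis) (scan w (fromTo (suc i) n) (c ++ vis))
  IH = scan-output P m (suc i) (c ++ vis) (trans (sym (+-suc i m)) eq) (s≤s z≤n) closed′ below′
         (All.++⁺ (inRange C) vis-inRange)
  fresh′ : ∀ {x} → x ∈ c ++ concat (scan w (fromTo (suc i) n) (c ++ vis)) → x ∉ vis
  fresh′ p with ∈-++⁻ c p
  ... | inj₁ q = c∩vis q
  ... | inj₂ q = out-fresh IH q ∘ ∈-++⁺ʳ c
  complete′ : ∀ {x} → InRange n x → x ∈ vis ⊎ x ∈ c ++ concat (scan w (fromTo (suc i) n) (c ++ vis))
  complete′ x∈ with out-complete IH x∈
  ... | inj₂ q = inj₂ (∈-++⁺ʳ c q)
  ... | inj₁ p with ∈-++⁻ c p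
  ...   | inj₁ q = inj₂ (∈-++⁺ˡ q)
  ...   | inj₂ q = inj₁ q
  head-below : ∀ {y} → y ∈ c → headOr0 c ≤ y
  head-below y∈ = subst (_≤ _) (sym head≡i) (≮⇒≥ (λ y<i → c∩vis y∈ (below (All.lookup (inRange C) y∈) y<i)))

cycles-cycleForm : ∀ {n w} → Perm n w → CycleForm n w (cycles w)
cycles-cycleForm {n} {w} P =
  mkStandardForm (out-nonempty O) (out-unique O) (out-sound O) complete′ (out-head-minimal O) (out-heads-increasing O) , out-cycles O
  where
  O : ScanOutput n (app w) 1 [] (cycles w)
  O = subst (λ L → ScanOutput n (app w) 1 [] (scan w (fromTo 1 L) [])) (sym (length≡n P))
        (scan-output P n 1 [] refl (s≤s z≤n) (λ ()) (λ { (() , _) (s≤s z≤n) }) [])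
  complete′ : ∀ {x} → InRange n x → x ∈ concat (cycles w)
  complete′ x∈ with out-complete O x∈
  ... | inj₂ q = q

follow-path : ∀ {w s} t f x → PathTo (app w) s x t → All (_≢ s) t → length t ≤ f → follow w s f x ≡ t
follow-path {w} {s} []      zero    x refl        _           _         = refl
follow-path {w} {s} []      (suc f) x refl        _           _         rewrite T-true (≡ᵇ-refl s) = refl
follow-path {w} {s} (y ∷ t) (suc f) x (refl , path) (y≢s ∷ t≢s) (s≤s len≤) rewrite ≡ᵇ-false y≢s =
  cong (y ∷_) (follow-path t f (app w y) path t≢s len≤)

cycleFrom-IsCycle : ∀ {n w s t} → Perm n w → IsCycle (app w) (s ∷ t) → Unique (s ∷ t) → All (InRange n) (s ∷ t) →
  cycleFrom w s ≡ s ∷ t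
cycleFrom-IsCycle {n} {w} {s} {t} P path (s∉ ∷ uniq) inRange = cong (s ∷_) (follow-path t (length w) (app w s) path
  (All.map (λ s≢ eq → s≢ (sym eq)) s∉)
  (<⇒≤ (subst (suc (length t) ≤_) (trans (fromTo-length 1 n) (sym (length≡n P)))
    (Unique-⊆⇒length≤ (s∉ ∷ uniq) (InRange⇒∈fromTo ∘ All.lookup inRange)))))

record ScanTarget (n : ℕ) (σ : ℕ → ℕ) (i : ℕ) (vis : List ℕ) (cs : List (List ℕ)) : Set where
  constructor mkScanTarget
  field
    tgt-cycles           : All (IsCycle σ) cs
    tgt-nonempty         : All (λ c → 1 ≤ length c) cs
    tgt-unique           : Unique (concat cs)
    tgt-sound            : All (InRange n) (concat cs)
    tgt-head-minimal     : All (λ c → All (headOr0 c ≤_) c) cs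
    tgt-heads-increasing : AllPairs _<_ (map headOr0 cs)
    tgt-heads-≥          : All (λ c → i ≤ headOr0 c) cs
    tgt-complete         : ∀ {x} → InRange n x → x ∈ vis ⊎ x ∈ concat cs
    tgt-fresh            : ∀ {x} → x ∈ vis → x ∉ concat cs
open ScanTarget

headOr0-∈ : ∀ {c : List ℕ} → 1 ≤ length c → headOr0 c ∈ c
headOr0-∈ {h ∷ c} _ = here refl

headOr0-∈-concat : ∀ {c} cs → c ∈ cs → 1 ≤ length c → headOr0 c ∈ concat cs
headOr0-∈-concat cs c∈ 1≤len = ∈-concat⁺′ (headOr0-∈ 1≤len) c∈

first-head : ∀ {n σ i vis c cs} → ScanTarget n σ i vis (c ∷ cs) → i ∈ concat (c ∷ cs) → headOr0 c ≡ i
first-head {c = c} {cs} T i∈ with ∈-++⁻ c i∈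
... | inj₁ p = ≤-antisym (All.lookup (All.head (tgt-head-minimal T)) p) (All.head (tgt-heads-≥ T))
... | inj₂ p with ∈-concat⁻′ cs p
...   | c′ , i∈c′ , c′∈ = ⊥-elim (<-irrefl refl (<-≤-trans
          (All.lookup (All.map⁻ (AllPairs.head (tgt-heads-increasing T))) c′∈)
          (≤-trans (All.lookup (All.lookup (All.tail (tgt-head-minimal T)) c′∈) i∈c′) (All.head (tgt-heads-≥ T)))))

scan-recovers : ∀ {n w} → Perm n w → ∀ m i vis cs → i + m ≡ suc n → 1 ≤ i →
  ScanTarget n (app w) i vis cs → scan w (fromTo i n) vis ≡ cs
scan-recovers {n} {w} P zero i vis cs i≡1+n _ T rewrite trans (sym (+-identityʳ i)) i≡1+n with cs
... | []     rewrite fromTo-empty {suc n} {n} ≤-refl = refl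
... | c ∷ cs = ⊥-elim (<⇒≱ (All.head (tgt-heads-≥ T))
    (proj₂ (All.lookup (tgt-sound T) (headOr0-∈-concat (c ∷ cs) (here refl) (All.head (tgt-nonempty T))))))
scan-recovers {n} {w} P (suc m) i vis cs eq 1≤i T rewrite fromTo-step (+suc≡⇒≤ i m n eq) with T? (any (i ≡ᵇ_) vis)
... | yes i∈vis rewrite T-true i∈vis = scan-recovers P m (suc i) vis cs (trans (sym (+-suc i m)) eq) (s≤s z≤n)
      (mkScanTarget (tgt-cycles T) (tgt-nonempty T) (tgt-unique T) (tgt-sound T) (tgt-head-minimal T)
        (tgt-heads-increasing T) (All.tabulate heads>i) (tgt-complete T) (tgt-fresh T))
  where
  heads>i : ∀ {c} → c ∈ cs → suc i ≤ headOr0 c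
  heads>i c∈ = ≤∧≢⇒< (All.lookup (tgt-heads-≥ T) c∈) (λ eq → tgt-fresh T (any-≡ᵇ⇒∈ vis i∈vis)
    (subst (_∈ concat cs) (sym eq) (headOr0-∈-concat cs c∈ (All.lookup (tgt-nonempty T) c∈))))
... | no i∉vis rewrite T-false i∉vis = step cs T i∈cs
  where
  i∈cs : i ∈ concat cs
  i∈cs with tgt-complete T (1≤i , +suc≡⇒≤ i m n eq)
  ... | inj₁ p = ⊥-elim (i∉vis (∈⇒any-≡ᵇ p))
  ... | inj₂ p = p
  step : ∀ cs → ScanTarget n (app w) i vis cs → i ∈ concat cs →
    cycleFrom w i ∷ scan w (fromTo (suc i) n) (cycleFrom w i ++ vis) ≡ cs
  step ([] ∷ _) T _ with All.head (tgt-nonempty T)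
  ... | ()
  step ((h ∷ t) ∷ cs) T i∈ with first-head T i∈
  ... | refl = trans
    (cong (λ c → c ∷ scan w (fromTo (suc h) n) (c ++ vis))
      (cycleFrom-IsCycle P (All.head (tgt-cycles T)) (Unique-++⁻ˡ (h ∷ t) (tgt-unique T)) (All.++⁻ˡ (h ∷ t) (tgt-sound T))))
    (cong ((h ∷ t) ∷_) (scan-recovers P m (suc h) ((h ∷ t) ++ vis) cs (trans (sym (+-suc h m)) eq) (s≤s z≤n)
      (mkScanTarget (All.tail (tgt-cycles T)) (All.tail (tgt-nonempty T)) (Unique-++⁻ʳ (h ∷ t) (tgt-unique T))
        (All.++⁻ʳ (h ∷ t) (tgt-sound T)) (All.tail (tgt-head-minimal T)) (AllPairs.tail (tgt-heads-increasing T))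
        (All.map⁻ (AllPairs.head (tgt-heads-increasing T))) complete′ fresh′)))
    where
    complete′ : ∀ {x} → InRange n x → x ∈ (h ∷ t) ++ vis ⊎ x ∈ concat cs
    complete′ x∈ with tgt-complete T x∈
    ... | inj₁ p = inj₁ (∈-++⁺ʳ (h ∷ t) p)
    ... | inj₂ p with ∈-++⁻ (h ∷ t) p
    ...   | inj₁ q = inj₁ (∈-++⁺ˡ q)
    ...   | inj₂ q = inj₂ q
    fresh′ : ∀ {x} → x ∈ (h ∷ t) ++ vis → x ∉ concat cs
    fresh′ p with ∈-++⁻ (h ∷ t) p
    ... | inj₁ q = Unique-++⇒disjoint (h ∷ t) (tgt-unique T) q
    ... | inj₂ q = tgt-fresh T q ∘ ∈-++⁺ʳ (h ∷ t)

cycleForm-unique : ∀ {n w cs} → Perm n w → CycleForm n w cs → cycles w ≡ cs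
cycleForm-unique {n} {w} {cs} P (F , cyc) = subst (λ L → scan w (fromTo 1 L) [] ≡ cs) (sym (length≡n P))
  (scan-recovers P n 1 [] cs refl (s≤s z≤n)
    (mkScanTarget cyc (nonempty F) (flat-unique F) (flat-sound F) (head-minimal F) (heads-increasing F)
      (All.tabulate (λ c∈ → proj₁ (All.lookup (flat-sound F) (headOr0-∈-concat cs c∈ (All.lookup (nonempty F) c∈)))))
      (inj₂ ∘ flat-complete F) (λ ())))

succWrap : ℕ → List ℕ → ℕ → ℕ
succWrap h []          x = 0
succWrap h (a ∷ [])    x = h
succWrap h (a ∷ b ∷ l) x = if a ≡ᵇ x then b else succWrap h (b ∷ l) x

succInCycle : List ℕ → ℕ → ℕ
succInCycle []      x = 0
succInCycle (h ∷ t) x = succWrap h (h ∷ t) x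

succInCycles : List (List ℕ) → ℕ → ℕ
succInCycles []       x = 0
succInCycles (c ∷ cs) x = if any (x ≡ᵇ_) c then succInCycle c x else succInCycles cs x

toOneLine : ℕ → List (List ℕ) → List ℕ
toOneLine n cs = map (succInCycles cs) (fromTo 1 n)

succWrap-PathTo : ∀ {σ h x} a l → PathTo σ h (σ a) l → x ∈ a ∷ l → succWrap h (a ∷ l) x ≡ σ x
succWrap-PathTo a []      e         (here refl) = sym e
succWrap-PathTo {σ} {x = x} a (b ∷ l) (e , path) x∈ with a ≟ x
... | yes refl rewrite T-true (≡ᵇ-refl a) = sym e
... | no a≢x   rewrite ≡ᵇ-false a≢x = succWrap-PathTo b l path (x∈bl x∈)
  where
  x∈bl : x ∈ a ∷ b ∷ l → x ∈ b ∷ l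
  x∈bl (here refl) = ⊥-elim (a≢x refl)
  x∈bl (there p)   = p

succInCycle-IsCycle : ∀ {σ x} c → IsCycle σ c → x ∈ c → succInCycle c x ≡ σ x
succInCycle-IsCycle (h ∷ t) = succWrap-PathTo h t

succInCycles-IsCycle : ∀ {σ x} cs → All (IsCycle σ) cs → x ∈ concat cs → succInCycles cs x ≡ σ x
succInCycles-IsCycle {x = x} (c ∷ cs) (cyc ∷ cycs) x∈ with T? (any (x ≡ᵇ_) c)
... | yes x∈c rewrite T-true x∈c = succInCycle-IsCycle c cyc (any-≡ᵇ⇒∈ c x∈c)
... | no x∉c rewrite T-false x∉c with ∈-++⁻ c x∈
...   | inj₁ p = ⊥-elim (x∉c (∈⇒any-≡ᵇ p))
...   | inj₂ p = succInCycles-IsCycle cs cycs p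

toOneLine-cycleForm : ∀ {n w cs} → Perm n w → CycleForm n w cs → toOneLine n cs ≡ w
toOneLine-cycleForm {n} {w} {cs} P (F , cyc) = begin
  map (succInCycles cs) (fromTo 1 n)          ≡⟨ List.map-cong-local (All.tabulate (λ x∈ → succInCycles-IsCycle cs cyc (flat-complete F (fromTo-∈⁻ x∈)))) ⟩
  map (app w) (fromTo 1 n)                     ≡⟨ cong (λ L → map (app w) (fromTo 1 L)) (sym (length≡n P)) ⟩
  map (app w) (fromTo 1 (length w))            ≡⟨ map-app-fromTo w ⟩
  w                                            ∎
  where open ≡-Reasoning

IsCycle-succInCycle : ∀ c → Unique c → 1 ≤ length c → IsCycle (succInCycle c) c
IsCycle-succInCycle (h ∷ t) uniq _ = go h t (λ _ → refl) uniq
  where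
  go : ∀ a l → (∀ {y} → y ∈ a ∷ l → succInCycle (h ∷ t) y ≡ succWrap h (a ∷ l) y) → Unique (a ∷ l) →
    PathTo (succInCycle (h ∷ t)) h (succInCycle (h ∷ t) a) l
  go a []      E _          = E (here refl)
  go a (b ∷ l) E (a∉ ∷ uniq) =
    trans (E (here refl)) (cong (λ z → if z then b else succWrap h (b ∷ l) a) (T-true (≡ᵇ-refl a))) ,
    go b l (λ {y} y∈ → trans (E (there y∈)) (cong (λ z → if z then b else succWrap h (b ∷ l) y) (≡ᵇ-false (All.lookup a∉ y∈)))) uniq

succInCycles-∈ : ∀ {c x} cs → Unique (concat cs) → c ∈ cs → x ∈ c → succInCycles cs x ≡ succInCycle c x
succInCycles-∈ {c} {x} (c′ ∷ cs) uniq (here refl) x∈ rewrite T-true (∈⇒any-≡ᵇ x∈) = refl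
succInCycles-∈ {c} {x} (c′ ∷ cs) uniq (there c∈) x∈
  rewrite T-false {any (x ≡ᵇ_) c′} (λ t → Unique-++⇒disjoint c′ uniq (any-≡ᵇ⇒∈ c′ t) (∈-concat⁺′ x∈ c∈)) =
  succInCycles-∈ cs (Unique-++⁻ʳ c′ uniq) c∈ x∈

IsCycle-cong : ∀ {σ τ} c → (∀ {y} → y ∈ c → σ y ≡ τ y) → IsCycle σ c → IsCycle τ c
IsCycle-cong {σ} {τ} (h ∷ t) eq cyc = subst (λ z → PathTo τ h z t) (eq (here refl)) (go t (eq ∘ there) cyc)
  where
  go : ∀ {x} t → (∀ {y} → y ∈ t → σ y ≡ τ y) → PathTo σ h x t → PathTo τ h x t
  go []      eq path        = path
  go (y ∷ t) eq (e , path) = e , subst (λ z → PathTo τ h z t) (eq (here refl)) (go t (eq ∘ there) path)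

app-toOneLine : ∀ {n x} cs → InRange n x → app (toOneLine n cs) x ≡ succInCycles cs x
app-toOneLine {n} {suc x} cs (_ , s≤s x≤) =
  trans (at-map (succInCycles cs) (fromTo 1 n) (subst (x <_) (sym (fromTo-length 1 n)) (s≤s x≤)))
        (cong (succInCycles cs) (at-applyUpTo (1 +_) (s≤s x≤)))

Unique-concat-∈ : ∀ {c} cs → Unique (concat cs) → c ∈ cs → Unique c
Unique-concat-∈ (c′ ∷ cs) uniq (here refl) = Unique-++⁻ˡ c′ uniq
Unique-concat-∈ (c′ ∷ cs) uniq (there c∈)  = Unique-concat-∈ cs (Unique-++⁻ʳ c′ uniq) c∈

PathTo-predecessor : ∀ {σ h v} a l → PathTo σ h (σ a) l → v ≡ h ⊎ v ∈ l → ∃ λ u → u ∈ a ∷ l × σ u ≡ v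
PathTo-predecessor a []      e          (inj₁ refl)        = a , here refl , e
PathTo-predecessor a (b ∷ l) (e , _)    (inj₂ (here refl)) = a , here refl , e
PathTo-predecessor a (b ∷ l) (_ , path) (inj₂ (there v∈))  with PathTo-predecessor b l path (inj₂ v∈)
... | u , u∈ , eq = u , there u∈ , eq
PathTo-predecessor a (b ∷ l) (_ , path) (inj₁ refl)        with PathTo-predecessor b l path (inj₁ refl)
... | u , u∈ , eq = u , there u∈ , eq

IsCycle-predecessor : ∀ {σ v} c → IsCycle σ c → v ∈ c → ∃ λ u → u ∈ c × σ u ≡ v
IsCycle-predecessor (h ∷ t) cyc (here refl) = PathTo-predecessor h t cyc (inj₁ refl)
IsCycle-predecessor (h ∷ t) cyc (there v∈)  = PathTo-predecessor h t cyc (inj₂ v∈)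

toOneLine-valid : ∀ {n cs} → StandardForm (InRange n) cs → CycleForm n (toOneLine n cs) cs × Perm n (toOneLine n cs)
toOneLine-valid {n} {cs} F = (F , All.tabulate cycle) , mkPerm len (All.map⁺ (All.tabulate (λ x∈ → succ-inRange (fromTo-∈⁻ x∈)))) uniq
  where
  len : length (toOneLine n cs) ≡ n
  len = trans (List.length-map (succInCycles cs) (fromTo 1 n)) (fromTo-length 1 n)
  own-cycle : ∀ {c} → c ∈ cs → IsCycle (succInCycle c) c
  own-cycle c∈ = IsCycle-succInCycle _ (Unique-concat-∈ cs (flat-unique F) c∈) (All.lookup (nonempty F) c∈)
  cycle : ∀ {c} → c ∈ cs → IsCycle (app (toOneLine n cs)) c
  cycle {c} c∈ = IsCycle-cong c (λ y∈ → trans (sym (succInCycles-∈ cs (flat-unique F) c∈ y∈))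
      (sym (app-toOneLine cs (All.lookup (flat-sound F) (∈-concat⁺′ y∈ c∈))))) (own-cycle c∈)
  succ-inRange : ∀ {x} → InRange n x → InRange n (succInCycles cs x)
  succ-inRange x∈ with ∈-concat⁻′ cs (flat-complete F x∈)
  ... | c , x∈c , c∈ = All.lookup (flat-sound F) (subst (_∈ concat cs) (sym (succInCycles-∈ cs (flat-unique F) c∈ x∈c))
          (∈-concat⁺′ (IsCycle-closed c (own-cycle c∈) x∈c) c∈))
  covers : ∀ {v} → v ∈ fromTo 1 n → v ∈ toOneLine n cs
  covers v∈ with ∈-concat⁻′ cs (flat-complete F (fromTo-∈⁻ v∈))
  ... | c , v∈c , c∈ with IsCycle-predecessor c (own-cycle c∈) v∈c
  ...   | u , u∈ , eq = subst (_∈ toOneLine n cs) (trans (succInCycles-∈ cs (flat-unique F) c∈ u∈) eq)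
            (∈-map⁺ (succInCycles cs) (InRange⇒∈fromTo (All.lookup (flat-sound F) (∈-concat⁺′ u∈ c∈))))
  uniq : Unique (toOneLine n cs)
  uniq = proj₁ (Unique-⊆-length≤ (fromTo-unique 1 n) covers (≤-reflexive (trans len (sym (fromTo-length 1 n)))))

record CycleFormBijection (m : ℕ) (P : List (List ℕ) → Set) (n : ℕ) (Q : List (List ℕ) → Set) : Set where
  field
    to         : List (List ℕ) → List (List ℕ)
    from       : List (List ℕ) → List (List ℕ)
    to-valid   : ∀ {cs} → StandardForm (InRange m) cs → P cs → StandardForm (InRange n) (to cs) × Q (to cs)
    from-valid : ∀ {cs} → StandardForm (InRange n) cs → Q cs → StandardForm (InRange m) (from cs) × P (from cs)
    from∘to    : ∀ {cs} → StandardForm (InRange m) cs → P cs → from (to cs) ≡ cs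
    to∘from    : ∀ {cs} → StandardForm (InRange n) cs → Q cs → to (from cs) ≡ cs

private
  transport : ∀ {m n} {P Q : List (List ℕ) → Set} {p q : List ℕ → Bool} (f g : List (List ℕ) → List (List ℕ)) →
    (∀ {cs} → StandardForm (InRange m) cs → P cs → StandardForm (InRange n) (f cs) × Q (f cs)) →
    (∀ {cs} → StandardForm (InRange m) cs → P cs → g (f cs) ≡ cs) →
    (∀ {w} → Perm m w → T (p w) → P (cycles w)) → (∀ {w} → Perm n w → Q (cycles w) → T (q w)) →
    ∀ {w} → w ∈ perms m → T (p w) →
    toOneLine n (f (cycles w)) ∈ perms n × T (q (toOneLine n (f (cycles w)))) ×
    toOneLine m (g (cycles (toOneLine n (f (cycles w))))) ≡ w
  transport {m} {n} {Q = Q} f g valid g∘f p⇒P Q⇒q {w} w∈ pw =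
    perms-∈⁺ (proj₂ C′) , Q⇒q (proj₂ C′) (subst Q (sym cycles≡) (proj₂ image)) , back
    where
    P : Perm m w
    P = perms-∈⁻ w∈
    C : CycleForm m w (cycles w)
    C = cycles-cycleForm P
    image : StandardForm (InRange n) (f (cycles w)) × Q (f (cycles w))
    image = valid (proj₁ C) (p⇒P P pw)
    C′ : CycleForm n (toOneLine n (f (cycles w))) (f (cycles w)) × Perm n (toOneLine n (f (cycles w)))
    C′ = toOneLine-valid (proj₁ image)
    cycles≡ : cycles (toOneLine n (f (cycles w))) ≡ f (cycles w)
    cycles≡ = cycleForm-unique (proj₂ C′) (proj₁ C′)
    back : toOneLine m (g (cycles (toOneLine n (f (cycles w))))) ≡ w
    back = trans (cong (toOneLine m ∘ g) cycles≡)
             (trans (cong (toOneLine m) (g∘f (proj₁ C) (p⇒P P pw))) (toOneLine-cycleForm P C))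

count-transfer : ∀ {m n P Q} {p q : List ℕ → Bool} → CycleFormBijection m P n Q →
  (∀ {w} → Perm m w → T (p w) ⇔ P (cycles w)) → (∀ {w} → Perm n w → T (q w) ⇔ Q (cycles w)) →
  count p (perms m) ≡ count q (perms n)
count-transfer {m} {n} {P} {Q} B p⇔ q⇔ = count-by-bijection
  (λ w → toOneLine n (to (cycles w))) (λ w → toOneLine m (from (cycles w))) (perms-unique m) (perms-unique n)
  (transport {P = P} {Q} to from to-valid from∘to (Equivalence.to ∘ p⇔) (Equivalence.from ∘ q⇔))
  (transport {P = Q} {P} from to from-valid to∘from (Equivalence.to ∘ q⇔) (Equivalence.from ∘ p⇔))
  where open CycleFormBijection B

Long : List ℕ → Set
Long c = 2 ≤ length c

PathTo-no-fixed-point : ∀ {σ h y x} l → PathTo σ h y l → Unique l → h ∉ l → x ∈ l → σ x ≢ x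
PathTo-no-fixed-point (b ∷ l) (_ , path) (b∉ ∷ _) h∉ (here refl) fixed with PathTo-start l path
... | inj₁ p = All.lookup b∉ p (sym fixed)
... | inj₂ q = h∉ (here (trans (sym q) fixed))
PathTo-no-fixed-point (b ∷ l) (_ , path) (_ ∷ uniq) h∉ (there x∈) fixed =
  PathTo-no-fixed-point l path uniq (h∉ ∘ there) x∈ fixed

IsCycle-no-fixed-point : ∀ {σ x} c → IsCycle σ c → Unique c → Long c → x ∈ c → σ x ≢ x
IsCycle-no-fixed-point (h ∷ [])    _ _ (s≤s ()) _
IsCycle-no-fixed-point (h ∷ b ∷ t) (e , _)    (h∉ ∷ _)    _ (here refl) fixed = All.lookup h∉ (here refl) (trans (sym fixed) e)
IsCycle-no-fixed-point (h ∷ b ∷ t) (e , path) (h∉ ∷ uniq) _ (there x∈)  fixed =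
  PathTo-no-fixed-point (b ∷ t) (e , path) uniq (λ h∈ → All.lookup h∉ h∈ refl) x∈ fixed

isDerangement⇔ : ∀ {n w cs} → Perm n w → CycleForm n w cs → T (isDerangement w) ⇔ All Long cs
isDerangement⇔ {n} {w} {cs} P (F , cyc) = mk⇔ to from
  where
  ∈fromTo : ∀ {x} → InRange n x → x ∈ fromTo 1 (length w)
  ∈fromTo x∈ = subst (λ L → _ ∈ fromTo 1 L) (sym (length≡n P)) (InRange⇒∈fromTo x∈)
  to : T (isDerangement w) → All Long cs
  to t = All.tabulate (λ c∈ → long _ (All.lookup (nonempty F) c∈) (All.lookup cyc c∈) c∈)
    where
    long : ∀ c → 1 ≤ length c → IsCycle (app w) c → c ∈ cs → Long c
    long (h ∷ [])    _ fixed c∈ = ⊥-elim (T-not⁻ (All.lookup (All.all⁺ _ _ t)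
      (∈fromTo (All.lookup (flat-sound F) (∈-concat⁺′ (here refl) c∈)))) (≡⇒≡ᵇ _ _ fixed))
    long (h ∷ b ∷ c) _ _     _  = s≤s (s≤s z≤n)
  from : All Long cs → T (isDerangement w)
  from long = All.all⁻ _ (All.tabulate (λ x∈ → T-not (λ q → moves x∈ (≡ᵇ⇒≡ _ _ q))))
    where
    moves : ∀ {x} → x ∈ fromTo 1 (length w) → app w x ≢ x
    moves x∈ with ∈-concat⁻′ cs (flat-complete F (subst (λ L → InRange L _) (length≡n P) (fromTo-∈⁻ x∈)))
    ... | c , x∈c , c∈ = IsCycle-no-fixed-point c (All.lookup cyc c∈) (Unique-concat-∈ cs (flat-unique F) c∈)
          (All.lookup long c∈) x∈c

-- The pattern 3-12

Occurs3-12 : List ℕ → Set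
Occurs3-12 w = ∃₂ λ i j → i < j × suc j < length w × at w j < at w (suc j) × at w (suc j) < at w i

Avoids3-12 : List ℕ → Set
Avoids3-12 w = ¬ Occurs3-12 w

contains3-12⇔ : ∀ w → T (contains3-12 w) ⇔ Occurs3-12 w
contains3-12⇔ w = mk⇔ to from
  where
  to : T (contains3-12 w) → Occurs3-12 w
  to t with find (Any.any⁻ _ (upTo (length w ∸ 1)) t)
  ... | j , j∈ , t′ with find (Any.any⁻ _ (upTo j) t′)
  ...   | i , i∈ , t″ = let a , b = T-∧⁻ t″ in
    i , j , ∈-upTo⁻ i∈ , ≤-trans (s≤s (∈-upTo⁻ j∈)) (≤-reflexive (m+[n∸m]≡n (≤-trans (s≤s z≤n) (<-≤-trans (∈-upTo⁻ j∈) (m∸n≤m (length w) 1))))) ,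
    <ᵇ⇒< _ _ a , <ᵇ⇒< _ _ b
  from : Occurs3-12 w → T (contains3-12 w)
  from (i , j , i<j , j+1<len , lo<mid , mid<hi) =
    Any.any⁺ _ (lose (∈-upTo⁺ (∸-monoˡ-< {suc j} {1} {length w} j+1<len (s≤s z≤n)))
      (Any.any⁺ _ (lose (∈-upTo⁺ i<j) (T-∧⁺ (<⇒<ᵇ lo<mid) (<⇒<ᵇ mid<hi)))))

occurs-++ : ∀ u v → Occurs3-12 u → Occurs3-12 (u ++ v)
occurs-++ u v (i , j , i<j , j+1<len , lo<mid , mid<hi) =
  i , j , i<j , ≤-trans j+1<len (≤-trans (m≤m+n (length u) (length v)) (≤-reflexive (sym (List.length-++ u)))) ,
  subst₂ _<_ (sym (at-++ˡ u v j<len)) (sym (at-++ˡ u v j+1<len)) lo<mid ,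
  subst₂ _<_ (sym (at-++ˡ u v j+1<len)) (sym (at-++ˡ u v (<-trans i<j j<len))) mid<hi
  where
  j<len : j < length u
  j<len = <-trans (n<1+n _) j+1<len

avoids-++⁻ : ∀ u v → Avoids3-12 (u ++ v) → Avoids3-12 u
avoids-++⁻ u v avoids = avoids ∘ occurs-++ u v

occurs-∷ʳ⁻ : ∀ u x → Occurs3-12 (u ∷ʳ x) → Occurs3-12 u ⊎ (lastOr0 u < x × ∃ λ y → y ∈ u × x < y)
occurs-∷ʳ⁻ u x (i , j , i<j , j+1<len , lo<mid , mid<hi) with m<1+n⇒m<n∨m≡n (subst (suc j <_) (length-∷ʳ u x) j+1<len)
... | inj₁ j+1<len′ = inj₁ (i , j , i<j , j+1<len′ ,
        subst₂ _<_ (at-++ˡ u _ (<-trans (n<1+n j) j+1<len′)) (at-++ˡ u _ j+1<len′) lo<mid ,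
        subst₂ _<_ (at-++ˡ u _ j+1<len′) (at-++ˡ u _ (<-trans i<j (<-trans (n<1+n j) j+1<len′))) mid<hi)
... | inj₂ j+1≡len = inj₂ (subst (_< x) (sym last≡) (subst₂ _<_ (at-++ˡ u _ j<len) x≡ lo<mid) ,
        at u i , at-∈ u i<len , subst (_< at u i) x≡ (subst (at (u ∷ʳ x) (suc j) <_) (at-++ˡ u _ i<len) mid<hi))
  where
  j<len : j < length u
  j<len = subst (j <_) j+1≡len (n<1+n j)
  i<len : i < length u
  i<len = <-trans i<j j<len
  x≡ : at (u ∷ʳ x) (suc j) ≡ x
  x≡ = subst (λ k → at (u ∷ʳ x) k ≡ x) (sym j+1≡len) (at-∷ʳ-length u x)
  last≡ : lastOr0 u ≡ at u j
  last≡ = trans (lastOr0≡at u) (cong (at u ∘ (_∸ 1)) (sym j+1≡len))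

occurs-∷ʳ⁺ : ∀ u x {y} → y ∈ u → x < y → lastOr0 u < x → Occurs3-12 (u ∷ʳ x)
occurs-∷ʳ⁺ u x y∈ x<y last<x with ∈⇒at u y∈
... | k , k<len , refl = split (m<1+n⇒m<n∨m≡n (subst (k <_) (sym 1+[len-1]) k<len))
  where
  1+[len-1] : suc (length u ∸ 1) ≡ length u
  1+[len-1] = m+[n∸m]≡n {1} (≤-trans (s≤s z≤n) k<len)
  len-1<len : length u ∸ 1 < length u
  len-1<len = subst (length u ∸ 1 <_) 1+[len-1] (n<1+n _)
  x≡ : at (u ∷ʳ x) (suc (length u ∸ 1)) ≡ x
  x≡ = subst (λ k → at (u ∷ʳ x) k ≡ x) (sym 1+[len-1]) (at-∷ʳ-length u x)
  split : k < length u ∸ 1 ⊎ k ≡ length u ∸ 1 → Occurs3-12 (u ∷ʳ x)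
  split (inj₂ k≡)    = ⊥-elim (<-asym x<y (subst (_< x) (trans (lastOr0≡at u) (cong (at u) (sym k≡))) last<x))
  split (inj₁ k<len-1) = k , length u ∸ 1 , k<len-1 ,
    subst (_< length (u ∷ʳ x)) (sym 1+[len-1]) (subst (length u <_) (sym (length-∷ʳ u x)) (n<1+n _)) ,
    subst₂ _<_ (sym (trans (at-++ˡ u _ len-1<len) (sym (lastOr0≡at u)))) (sym x≡) last<x ,
    subst₂ _<_ (sym x≡) (sym (at-++ˡ u _ k<len)) x<y

avoids-∷ʳ-max : ∀ u x → Avoids3-12 u → All (_< x) u → Avoids3-12 (u ∷ʳ x)
avoids-∷ʳ-max u x avoids below occ with occurs-∷ʳ⁻ u x occ
... | inj₁ occ′ = avoids occ′
... | inj₂ (_ , y , y∈ , x<y) = <-asym x<y (All.lookup below y∈)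

avoids-∷ʳ-below-last : ∀ u x → Avoids3-12 u → x < lastOr0 u → Avoids3-12 (u ∷ʳ x)
avoids-∷ʳ-below-last u x avoids x<last occ with occurs-∷ʳ⁻ u x occ
... | inj₁ occ′ = avoids occ′
... | inj₂ (last<x , _) = <-asym x<last last<x

StrictlyMonotone : (ℕ → ℕ) → Set
StrictlyMonotone r = ∀ {a b} → a < b → r a < r b

occurs-map⁺ : ∀ {r} → StrictlyMonotone r → ∀ u → Occurs3-12 u → Occurs3-12 (map r u)
occurs-map⁺ {r} mono u (i , j , i<j , j+1<len , lo<mid , mid<hi) =
  i , j , i<j , subst (suc j <_) (sym (List.length-map r u)) j+1<len ,
  subst₂ _<_ (sym (at-map r u j<len)) (sym (at-map r u j+1<len)) (mono lo<mid) ,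
  subst₂ _<_ (sym (at-map r u j+1<len)) (sym (at-map r u (<-trans i<j j<len))) (mono mid<hi)
  where
  j<len : j < length u
  j<len = <-trans (n<1+n _) j+1<len

StrictlyMonotone-reflects : ∀ {r} → StrictlyMonotone r → ∀ {a b} → r a < r b → a < b
StrictlyMonotone-reflects mono {a} {b} ra<rb with <-cmp a b
... | tri< a<b _ _ = a<b
... | tri≈ _ refl _ = ⊥-elim (<-irrefl refl ra<rb)
... | tri> _ _ b<a = ⊥-elim (<-asym ra<rb (mono b<a))

occurs-map⁻ : ∀ {r} → StrictlyMonotone r → ∀ u → Occurs3-12 (map r u) → Occurs3-12 u
occurs-map⁻ {r} mono u (i , j , i<j , j+1<len′ , lo<mid , mid<hi) =
  i , j , i<j , j+1<len ,
  StrictlyMonotone-reflects mono (subst₂ _<_ (at-map r u j<len) (at-map r u j+1<len) lo<mid) ,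
  StrictlyMonotone-reflects mono (subst₂ _<_ (at-map r u j+1<len) (at-map r u (<-trans i<j j<len)) mid<hi)
  where
  j+1<len : suc j < length u
  j+1<len = subst (suc j <_) (List.length-map r u) j+1<len′
  j<len : j < length u
  j<len = <-trans (n<1+n _) j+1<len

avoids-∷ʳ⇒≤last : ∀ u x {y} → Avoids3-12 (u ∷ʳ x) → y ∈ u → x < y → x ≤ lastOr0 u
avoids-∷ʳ⇒≤last u x avoids y∈ x<y = ≮⇒≥ (avoids ∘ occurs-∷ʳ⁺ u x y∈ x<y)

-- The last cycle

initL : ∀ {A : Set} → List A → List A
initL []          = []
initL (x ∷ [])    = []
initL (x ∷ y ∷ l) = x ∷ initL (y ∷ l)

mapLast : ∀ {A : Set} → (A → A) → List A → List A
mapLast f []          = []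
mapLast f (x ∷ [])    = f x ∷ []
mapLast f (x ∷ y ∷ l) = x ∷ mapLast f (y ∷ l)

initL-∷ʳ : ∀ {A : Set} (xs : List A) x → initL (xs ∷ʳ x) ≡ xs
initL-∷ʳ []          x = refl
initL-∷ʳ (y ∷ [])    x = refl
initL-∷ʳ (y ∷ z ∷ xs) x = cong (y ∷_) (initL-∷ʳ (z ∷ xs) x)

mapLast-∷ʳ : ∀ {A : Set} (f : A → A) (xs : List A) x → mapLast f (xs ∷ʳ x) ≡ xs ∷ʳ f x
mapLast-∷ʳ f []           x = refl
mapLast-∷ʳ f (y ∷ [])     x = refl
mapLast-∷ʳ f (y ∷ z ∷ xs) x = cong (y ∷_) (mapLast-∷ʳ f (z ∷ xs) x)

lastCycle-∷ʳ : ∀ pre (L : List ℕ) → lastCycle (pre ∷ʳ L) ≡ L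
lastCycle-∷ʳ []          L = refl
lastCycle-∷ʳ (c ∷ [])    L = refl
lastCycle-∷ʳ (c ∷ d ∷ pre) L = lastCycle-∷ʳ (d ∷ pre) L

lastOr0-∷ʳ : ∀ (u : List ℕ) x → lastOr0 (u ∷ʳ x) ≡ x
lastOr0-∷ʳ []          x = refl
lastOr0-∷ʳ (y ∷ [])    x = refl
lastOr0-∷ʳ (y ∷ z ∷ u) x = lastOr0-∷ʳ (z ∷ u) x

lastOr0-++ : ∀ (u L : List ℕ) → 1 ≤ length L → lastOr0 (u ++ L) ≡ lastOr0 L
lastOr0-++ []          L       _ = refl
lastOr0-++ (x ∷ [])    (y ∷ L) _ = refl
lastOr0-++ (x ∷ y ∷ u) L       ne = lastOr0-++ (y ∷ u) L ne

lastOr0-∈ : ∀ (L : List ℕ) → 1 ≤ length L → lastOr0 L ∈ L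
lastOr0-∈ (x ∷ [])    _ = here refl
lastOr0-∈ (x ∷ y ∷ L) _ = there (lastOr0-∈ (y ∷ L) (s≤s z≤n))

headOr0-∷ʳ : ∀ (L : List ℕ) x → 1 ≤ length L → headOr0 (L ∷ʳ x) ≡ headOr0 L
headOr0-∷ʳ (h ∷ L) x _ = refl

headOr0-map : ∀ (r : ℕ → ℕ) (c : List ℕ) → 1 ≤ length c → headOr0 (map r c) ≡ r (headOr0 c)
headOr0-map r (h ∷ c) _ = refl

lastOr0-map : ∀ (r : ℕ → ℕ) (c : List ℕ) → 1 ≤ length c → lastOr0 (map r c) ≡ r (lastOr0 c)
lastOr0-map r (h ∷ [])    _ = refl
lastOr0-map r (h ∷ a ∷ c) _ = lastOr0-map r (a ∷ c) (s≤s z≤n)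

concat-∷ʳ : ∀ (pre : List (List ℕ)) L → concat (pre ∷ʳ L) ≡ concat pre ++ L
concat-∷ʳ pre L = trans (sym (List.concat-++ pre (L ∷ []))) (cong (concat pre ++_) (List.++-identityʳ L))

++-∷ʳ : ∀ (u L : List ℕ) x → u ++ (L ∷ʳ x) ≡ (u ++ L) ∷ʳ x
++-∷ʳ u L x = sym (List.++-assoc u L (x ∷ []))

∈-∷ʳ⁻ : ∀ (u : List ℕ) x {y} → y ∈ u ∷ʳ x → y ∈ u ⊎ y ≡ x
∈-∷ʳ⁻ u x p with ∈-++⁻ u p
... | inj₁ q        = inj₁ q
... | inj₂ (here e) = inj₂ e

∷ʳ-view : ∀ {A : Set} (xs : List A) → 1 ≤ length xs → ∃₂ λ ys y → xs ≡ ys ∷ʳ y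
∷ʳ-view xs ne with initLast xs
... | ys ∷ʳ′ y = ys , y , refl

lastCycle-split : ∀ cs → 1 ≤ headOr0 (lastCycle cs) → ∃₂ λ pre L → cs ≡ pre ∷ʳ L
lastCycle-split []       ()
lastCycle-split (c ∷ cs) _ = ∷ʳ-view (c ∷ cs) (s≤s z≤n)

last-split : ∀ (L : List ℕ) → 1 ≤ lastOr0 L → ∃ λ M → L ≡ M ∷ʳ lastOr0 L
last-split []      ()
last-split (x ∷ L) _ with ∷ʳ-view (x ∷ L) (s≤s z≤n)
... | M , y , eq = M , trans eq (cong (M ∷ʳ_) (sym (trans (cong lastOr0 eq) (lastOr0-∷ʳ M y))))

head≢last⇒Long : ∀ (L : List ℕ) → headOr0 L ≢ lastOr0 L → Long L
head≢last⇒Long []          h≢l = ⊥-elim (h≢l refl)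
head≢last⇒Long (h ∷ [])    h≢l = ⊥-elim (h≢l refl)
head≢last⇒Long (h ∷ a ∷ L) _   = s≤s (s≤s z≤n)

Unique-Long⇒head≢last : ∀ (L : List ℕ) → Unique L → Long L → headOr0 L ≢ lastOr0 L
Unique-Long⇒head≢last (h ∷ [])    _        (s≤s ())
Unique-Long⇒head≢last (h ∷ a ∷ L) (h∉ ∷ _) _ h≡last = All.lookup h∉ (lastOr0-∈ (a ∷ L) (s≤s z≤n)) h≡last

lastCycle-head : ∀ pre L {i} → headOr0 (lastCycle (pre ∷ʳ L)) ≡ i → headOr0 L ≡ i
lastCycle-head pre L = trans (cong headOr0 (sym (lastCycle-∷ʳ pre L)))

lastCycle-last : ∀ pre L {j} → lastOr0 (lastCycle (pre ∷ʳ L)) ≡ j → lastOr0 L ≡ j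
lastCycle-last pre L = trans (cong lastOr0 (sym (lastCycle-∷ʳ pre L)))

pair-shape : ∀ (L : List ℕ) {a b} → headOr0 L ≡ a → lastOr0 L ≡ b → a ≢ b → length L ≤ 2 → L ≡ a ∷ b ∷ []
pair-shape []          refl refl a≢b _ = ⊥-elim (a≢b refl)
pair-shape (h ∷ [])    refl refl a≢b _ = ⊥-elim (a≢b refl)
pair-shape (h ∷ x ∷ []) refl refl _  _ = refl
pair-shape (h ∷ x ∷ y ∷ L) _ _ _ (s≤s (s≤s ()))

map-map-∷ʳ : ∀ (f : ℕ → ℕ) pre (L : List ℕ) → map (map f) (pre ∷ʳ L) ≡ map (map f) pre ∷ʳ map f L
map-map-∷ʳ f pre L = List.map-++ (map f) pre (L ∷ [])

map-map-inverse : ∀ (f g : ℕ → ℕ) cs → (∀ {x} → x ∈ concat cs → g (f x) ≡ x) → map (map g) (map (map f) cs) ≡ cs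
map-map-inverse f g []       inv = refl
map-map-inverse f g (c ∷ cs) inv = cong₂ _∷_
  (trans (sym (List.map-∘ c)) (trans (List.map-cong-local (All.tabulate (inv ∘ ∈-++⁺ˡ))) (List.map-id c)))
  (map-map-inverse f g cs (inv ∘ ∈-++⁺ʳ c))

record LastCycleForm (S : ℕ → Set) (pre : List (List ℕ)) (L : List ℕ) : Set where
  constructor mkLastCycleForm
  field
    pre-nonempty         : All (λ c → 1 ≤ length c) pre
    last-nonempty        : 1 ≤ length L
    all-unique           : Unique (concat pre ++ L)
    all-sound            : All S (concat pre ++ L)
    all-complete         : ∀ {x} → S x → x ∈ concat pre ++ L
    pre-head-minimal     : All (λ c → All (headOr0 c ≤_) c) pre
    last-head-minimal    : All (headOr0 L ≤_) L
    pre-heads-increasing : AllPairs _<_ (map headOr0 pre)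
    pre-heads-below      : All (_< headOr0 L) (map headOr0 pre)
open LastCycleForm public

AllPairs-∷ʳ⁻ : ∀ {A : Set} {R : A → A → Set} xs {y} → AllPairs R (xs ∷ʳ y) → AllPairs R xs × All (λ x → R x y) xs
AllPairs-∷ʳ⁻ []       _              = [] , []
AllPairs-∷ʳ⁻ (x ∷ xs) (Rx ∷ pairs) with All.∷ʳ⁻ Rx | AllPairs-∷ʳ⁻ xs pairs
... | Rxs , Rxy | pairs′ , Ry = (Rxs ∷ pairs′) , (Rxy ∷ Ry)

AllPairs-∷ʳ⁺ : ∀ {A : Set} {R : A → A → Set} {xs y} → AllPairs R xs → All (λ x → R x y) xs → AllPairs R (xs ∷ʳ y)
AllPairs-∷ʳ⁺ pairs Ry = AllPairs.++⁺ pairs ([] ∷ []) (All.map (_∷ []) Ry)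

StandardForm⇒LastCycleForm : ∀ {S} pre L → StandardForm S (pre ∷ʳ L) → LastCycleForm S pre L
StandardForm⇒LastCycleForm {S} pre L F = mkLastCycleForm
  (proj₁ (All.∷ʳ⁻ (nonempty F))) (proj₂ (All.∷ʳ⁻ (nonempty F)))
  (subst Unique (concat-∷ʳ pre L) (flat-unique F)) (subst (All S) (concat-∷ʳ pre L) (flat-sound F))
  (subst (_ ∈_) (concat-∷ʳ pre L) ∘ flat-complete F)
  (proj₁ (All.∷ʳ⁻ (head-minimal F))) (proj₂ (All.∷ʳ⁻ (head-minimal F)))
  (proj₁ heads) (proj₂ heads)
  where
  heads : AllPairs _<_ (map headOr0 pre) × All (_< headOr0 L) (map headOr0 pre)
  heads = AllPairs-∷ʳ⁻ (map headOr0 pre) (subst (AllPairs _<_) (List.map-++ headOr0 pre (L ∷ [])) (heads-increasing F))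

LastCycleForm⇒StandardForm : ∀ {S pre L} → LastCycleForm S pre L → StandardForm S (pre ∷ʳ L)
LastCycleForm⇒StandardForm {S} {pre} {L} F = mkStandardForm (All.∷ʳ⁺ (pre-nonempty F) (last-nonempty F))
  (subst Unique (sym (concat-∷ʳ pre L)) (all-unique F)) (subst (All S) (sym (concat-∷ʳ pre L)) (all-sound F))
  (subst (_ ∈_) (sym (concat-∷ʳ pre L)) ∘ all-complete F)
  (All.∷ʳ⁺ (pre-head-minimal F) (last-head-minimal F))
  (subst (AllPairs _<_) (sym (List.map-++ headOr0 pre (L ∷ []))) (AllPairs-∷ʳ⁺ (pre-heads-increasing F) (pre-heads-below F)))

StandardForm-resp : ∀ {S S′ cs} → S ≐ S′ → StandardForm S cs → StandardForm S′ cs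
StandardForm-resp (S⊆S′ , S′⊆S) (mkStandardForm ne uniq sound complete hmin hinc) =
  mkStandardForm ne uniq (All.map S⊆S′ sound) (complete ∘ S′⊆S) hmin hinc

LastCycleForm-resp : ∀ {S S′ pre L} → S ≐ S′ → LastCycleForm S pre L → LastCycleForm S′ pre L
LastCycleForm-resp (S⊆S′ , S′⊆S) (mkLastCycleForm ne ne′ uniq sound complete hmin hmin′ hinc hbelow) =
  mkLastCycleForm ne ne′ uniq (All.map S⊆S′ sound) (complete ∘ S′⊆S) hmin hmin′ hinc hbelow

LastCycleForm-extend : ∀ {S pre L x} → LastCycleForm S pre L → ¬ S x → headOr0 L ≤ x →
  LastCycleForm (S ∪ ｛ x ｝) pre (L ∷ʳ x)
LastCycleForm-extend {S} {pre} {L} {x} F x∉S head≤x = mkLastCycleForm (pre-nonempty F)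
  (subst (1 ≤_) (sym (length-∷ʳ L x)) (s≤s z≤n))
  (subst Unique (sym (++-∷ʳ (concat pre) L x)) (Unique-∷ʳ (all-unique F) (x∉S ∘ All.lookup (all-sound F))))
  (subst (All (S ∪ ｛ x ｝)) (sym (++-∷ʳ (concat pre) L x)) (All.∷ʳ⁺ (All.map inj₁ (all-sound F)) (inj₂ refl)))
  complete
  (pre-head-minimal F)
  (subst (λ h → All (h ≤_) (L ∷ʳ x)) (sym head≡) (All.∷ʳ⁺ (last-head-minimal F) head≤x))
  (pre-heads-increasing F)
  (subst (λ h → All (_< h) (map headOr0 pre)) (sym head≡) (pre-heads-below F))
  where
  head≡ : headOr0 (L ∷ʳ x) ≡ headOr0 L
  head≡ = headOr0-∷ʳ L x (last-nonempty F)
  complete : ∀ {y} → (S ∪ ｛ x ｝) y → y ∈ concat pre ++ (L ∷ʳ x)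
  complete (inj₁ y∈S)  = subst (_ ∈_) (sym (++-∷ʳ (concat pre) L x)) (∈-++⁺ˡ (all-complete F y∈S))
  complete (inj₂ refl) = subst (_ ∈_) (sym (++-∷ʳ (concat pre) L x)) (∈-++⁺ʳ (concat pre ++ L) (here refl))

LastCycleForm-shrink : ∀ {S pre M x} → LastCycleForm S pre (M ∷ʳ x) → 1 ≤ length M →
  LastCycleForm (S ∩ ∁ ｛ x ｝) pre M
LastCycleForm-shrink {S} {pre} {M} {x} F 1≤len = mkLastCycleForm (pre-nonempty F) 1≤len
  (Unique-++⁻ˡ u uniq) (All.tabulate (λ y∈ → All.lookup sound (∈-++⁺ˡ y∈) , λ x≡y → ≢x y∈ (sym x≡y))) complete
  (pre-head-minimal F)
  (proj₁ (All.∷ʳ⁻ (subst (λ h → All (h ≤_) (M ∷ʳ x)) head≡ (last-head-minimal F))))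
  (pre-heads-increasing F)
  (subst (λ h → All (_< h) (map headOr0 pre)) head≡ (pre-heads-below F))
  where
  u : List ℕ
  u = concat pre ++ M
  head≡ : headOr0 (M ∷ʳ x) ≡ headOr0 M
  head≡ = headOr0-∷ʳ M x 1≤len
  uniq : Unique (u ∷ʳ x)
  uniq = subst Unique (++-∷ʳ (concat pre) M x) (all-unique F)
  sound : All S (u ∷ʳ x)
  sound = subst (All S) (++-∷ʳ (concat pre) M x) (all-sound F)
  ≢x : ∀ {y} → y ∈ u → y ≢ x
  ≢x y∈ refl = Unique-++⇒disjoint u uniq y∈ (here refl)
  complete : ∀ {y} → (S ∩ ∁ ｛ x ｝) y → y ∈ u
  complete (y∈S , x≢y) with ∈-∷ʳ⁻ u x (subst (_ ∈_) (++-∷ʳ (concat pre) M x) (all-complete F y∈S))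
  ... | inj₁ y∈u = y∈u
  ... | inj₂ y≡x = ⊥-elim (x≢y (sym y≡x))

LastCycleForm-new : ∀ {S cs a b} → StandardForm S cs → ¬ S a → ¬ S b → a < b → All (_< a) (map headOr0 cs) →
  LastCycleForm (S ∪ ｛ a ｝ ∪ ｛ b ｝) cs (a ∷ b ∷ [])
LastCycleForm-new {S} {cs} {a} {b} F a∉S b∉S a<b heads<a = mkLastCycleForm (nonempty F) (s≤s z≤n)
  (Unique.++⁺ (flat-unique F) (((λ a≡b → <-irrefl a≡b a<b) ∷ []) ∷ [] ∷ []) disjoint)
  (All.++⁺ (All.map inj₁ (flat-sound F)) (inj₂ (inj₁ refl) ∷ inj₂ (inj₂ refl) ∷ []))
  complete (head-minimal F) (≤-refl ∷ <⇒≤ a<b ∷ []) (heads-increasing F) heads<a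
  where
  disjoint : ∀ {y} → ¬ (y ∈ concat cs × y ∈ a ∷ b ∷ [])
  disjoint (y∈ , here refl)         = a∉S (All.lookup (flat-sound F) y∈)
  disjoint (y∈ , there (here refl)) = b∉S (All.lookup (flat-sound F) y∈)
  complete : ∀ {y} → (S ∪ ｛ a ｝ ∪ ｛ b ｝) y → y ∈ concat cs ++ a ∷ b ∷ []
  complete (inj₁ y∈S)         = ∈-++⁺ˡ (flat-complete F y∈S)
  complete (inj₂ (inj₁ refl)) = ∈-++⁺ʳ (concat cs) (here refl)
  complete (inj₂ (inj₂ refl)) = ∈-++⁺ʳ (concat cs) (there (here refl))

LastCycleForm-remove : ∀ {S cs a b} → LastCycleForm S cs (a ∷ b ∷ []) → StandardForm (S ∩ ∁ ｛ a ｝ ∩ ∁ ｛ b ｝) cs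
LastCycleForm-remove {S} {cs} {a} {b} F = mkStandardForm (pre-nonempty F) (Unique-++⁻ˡ (concat cs) (all-unique F))
  (All.tabulate (λ y∈ → All.lookup (all-sound F) (∈-++⁺ˡ y∈) ,
     (λ { refl → apart y∈ (here refl) }) , (λ { refl → apart y∈ (there (here refl)) })))
  complete (pre-head-minimal F) (pre-heads-increasing F)
  where
  apart : ∀ {y} → y ∈ concat cs → y ∉ a ∷ b ∷ []
  apart = Unique-++⇒disjoint (concat cs) (all-unique F)
  complete : ∀ {y} → (S ∩ ∁ ｛ a ｝ ∩ ∁ ｛ b ｝) y → y ∈ concat cs
  complete (y∈S , a≢y , b≢y) with ∈-++⁻ (concat cs) (all-complete F y∈S)
  ... | inj₁ y∈              = y∈
  ... | inj₂ (here refl)         = ⊥-elim (a≢y refl)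
  ... | inj₂ (there (here refl)) = ⊥-elim (b≢y refl)

StandardForm-map : ∀ {S S′ : ℕ → Set} {cs} (r : ℕ → ℕ) → (∀ {a b} → S a → S b → a < b → r a < r b) →
  (∀ {x} → S x → S′ (r x)) → (∀ {y} → S′ y → ∃ λ x → S x × r x ≡ y) →
  StandardForm S cs → StandardForm S′ (map (map r) cs)
StandardForm-map {S} {S′} {cs} r mono into onto F = mkStandardForm
  (All.map⁺ (All.map (λ {c} ne → subst (1 ≤_) (sym (List.length-map r c)) ne) (nonempty F)))
  (subst Unique flat≡ (Unique-map-on r (flat-unique F) injective))
  (subst (All S′) flat≡ (All.map⁺ (All.map into (flat-sound F))))
  (λ y∈ → let x , x∈S , rx≡y = onto y∈ in subst (_∈ concat (map (map r) cs)) rx≡y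
            (subst (r x ∈_) flat≡ (∈-map⁺ r (flat-complete F x∈S))))
  (All.map⁺ (All.tabulate head-minimal′))
  (subst (AllPairs _<_) (sym heads≡) (AllPairs.map⁺ (increasing (heads-increasing F) heads∈S)))
  where
  flat≡ : map r (concat cs) ≡ concat (map (map r) cs)
  flat≡ = sym (List.concat-map cs)
  mono≤ : ∀ {a b} → S a → S b → a ≤ b → r a ≤ r b
  mono≤ a∈ b∈ a≤b with m≤n⇒m<n∨m≡n a≤b
  ... | inj₁ a<b  = <⇒≤ (mono a∈ b∈ a<b)
  ... | inj₂ refl = ≤-refl
  injective : ∀ {a b} → a ∈ concat cs → b ∈ concat cs → r a ≡ r b → a ≡ b
  injective {a} {b} a∈ b∈ ra≡rb with <-cmp a b
  ... | tri< a<b _ _ = ⊥-elim (<-irrefl ra≡rb (mono (All.lookup (flat-sound F) a∈) (All.lookup (flat-sound F) b∈) a<b))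
  ... | tri≈ _ a≡b _ = a≡b
  ... | tri> _ _ b<a = ⊥-elim (<-irrefl (sym ra≡rb) (mono (All.lookup (flat-sound F) b∈) (All.lookup (flat-sound F) a∈) b<a))
  head∈S : ∀ {c} → c ∈ cs → S (headOr0 c)
  head∈S c∈ = All.lookup (flat-sound F) (headOr0-∈-concat cs c∈ (All.lookup (nonempty F) c∈))
  heads∈S : All S (map headOr0 cs)
  heads∈S = All.map⁺ (All.tabulate head∈S)
  head-minimal′ : ∀ {c} → c ∈ cs → All (headOr0 (map r c) ≤_) (map r c)
  head-minimal′ {c} c∈ = subst (λ h → All (h ≤_) (map r c)) (sym (headOr0-map r c (All.lookup (nonempty F) c∈)))
    (All.map⁺ (All.tabulate (λ y∈ → mono≤ (head∈S c∈) (All.lookup (flat-sound F) (∈-concat⁺′ y∈ c∈))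
      (All.lookup (All.lookup (head-minimal F) c∈) y∈))))
  heads≡ : map headOr0 (map (map r) cs) ≡ map r (map headOr0 cs)
  heads≡ = trans (sym (List.map-∘ cs)) (trans (List.map-cong-local (All.tabulate (λ {c} c∈ → headOr0-map r c (All.lookup (nonempty F) c∈))))
    (List.map-∘ cs))
  increasing : ∀ {hs} → AllPairs _<_ hs → All S hs → AllPairs (λ a b → r a < r b) hs
  increasing []               []            = []
  increasing (h<hs ∷ pairs) (h∈S ∷ hs∈S) =
    All.zipWith (λ (h<h′ , h′∈S) → mono h∈S h′∈S h<h′) (h<hs , hs∈S) ∷ increasing pairs hs∈S

-- The cycle forms counted by the coefficient of y^k in z_n.

record Admissible (k : ℕ) (cs : List (List ℕ)) : Set where
  constructor mkAdmissible
  field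
    all-long : All Long cs
    avoids   : Avoids3-12 (concat cs)
    size     : length cs ≡ k
open Admissible public

concat-∷ʳ-∷ʳ : ∀ pre (L : List ℕ) x → concat (pre ∷ʳ (L ∷ʳ x)) ≡ concat (pre ∷ʳ L) ∷ʳ x
concat-∷ʳ-∷ʳ pre L x = trans (concat-∷ʳ pre (L ∷ʳ x)) (trans (++-∷ʳ (concat pre) L x) (cong (_∷ʳ x) (sym (concat-∷ʳ pre L))))

concat-∷ʳ-pair : ∀ pre (M : List ℕ) a b → concat ((pre ∷ʳ M) ∷ʳ (a ∷ b ∷ [])) ≡ concat (pre ∷ʳ (M ∷ʳ a)) ∷ʳ b
concat-∷ʳ-pair pre M a b = begin
  concat ((pre ∷ʳ M) ∷ʳ (a ∷ b ∷ []))        ≡⟨ concat-∷ʳ (pre ∷ʳ M) (a ∷ b ∷ []) ⟩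
  concat (pre ∷ʳ M) ++ (a ∷ b ∷ [])          ≡⟨ List.++-assoc (concat (pre ∷ʳ M)) (a ∷ []) (b ∷ []) ⟨
  (concat (pre ∷ʳ M) ∷ʳ a) ∷ʳ b              ≡⟨ cong (_∷ʳ b) (concat-∷ʳ-∷ʳ pre M a) ⟨
  concat (pre ∷ʳ (M ∷ʳ a)) ∷ʳ b              ∎
  where open ≡-Reasoning

Admissible-extend : ∀ {k pre L x} → Admissible k (pre ∷ʳ L) → 1 ≤ length L →
  Avoids3-12 (concat (pre ∷ʳ L) ∷ʳ x) → Admissible k (pre ∷ʳ (L ∷ʳ x))
Admissible-extend {k} {pre} {L} {x} A 1≤len avoids′ = mkAdmissible
  (All.∷ʳ⁺ (proj₁ (All.∷ʳ⁻ (all-long A))) (subst (2 ≤_) (sym (length-∷ʳ L x)) (s≤s 1≤len)))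
  (subst Avoids3-12 (sym (concat-∷ʳ-∷ʳ pre L x)) avoids′)
  (trans (List.length-++ pre) (trans (sym (List.length-++ pre)) (size A)))

Admissible-shrink : ∀ {k pre M x} → Admissible k (pre ∷ʳ (M ∷ʳ x)) → Long M → Admissible k (pre ∷ʳ M)
Admissible-shrink {k} {pre} {M} {x} A long = mkAdmissible
  (All.∷ʳ⁺ (proj₁ (All.∷ʳ⁻ (all-long A))) long)
  (avoids-++⁻ (concat (pre ∷ʳ M)) (x ∷ []) (subst Avoids3-12 (concat-∷ʳ-∷ʳ pre M x) (avoids A)))
  (trans (List.length-++ pre) (trans (sym (List.length-++ pre)) (size A)))

Admissible-new : ∀ {k cs a b} → Admissible k cs → Avoids3-12 (concat cs ++ a ∷ b ∷ []) →
  Admissible (suc k) (cs ∷ʳ (a ∷ b ∷ []))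
Admissible-new {k} {cs} {a} {b} A avoids′ = mkAdmissible
  (All.∷ʳ⁺ (all-long A) (s≤s (s≤s z≤n)))
  (subst Avoids3-12 (sym (concat-∷ʳ cs (a ∷ b ∷ []))) avoids′)
  (trans (length-∷ʳ cs _) (cong suc (size A)))

Admissible-remove : ∀ {k cs a b} → Admissible (suc k) (cs ∷ʳ (a ∷ b ∷ [])) → Admissible k cs
Admissible-remove {k} {cs} {a} {b} A = mkAdmissible
  (proj₁ (All.∷ʳ⁻ (all-long A)))
  (avoids-++⁻ (concat cs) (a ∷ b ∷ []) (subst Avoids3-12 (concat-∷ʳ cs (a ∷ b ∷ [])) (avoids A)))
  (suc-injective (trans (sym (length-∷ʳ cs _)) (size A)))

Admissible-map : ∀ {k cs} (r : ℕ → ℕ) → StrictlyMonotone r → Admissible k cs ⇔ Admissible k (map (map r) cs)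
Admissible-map {k} {cs} r mono = mk⇔
  (λ A → mkAdmissible (All.map⁺ (All.map (λ {c} → subst (2 ≤_) (sym (List.length-map r c))) (all-long A)))
    (λ occ → avoids A (occurs-map⁻ mono (concat cs) (subst Occurs3-12 (List.concat-map cs) occ)))
    (trans (List.length-map (map r) cs) (size A)))
  (λ A → mkAdmissible (All.map (λ {c} → subst (2 ≤_) (List.length-map r c)) (All.map⁻ (all-long A)))
    (λ occ → avoids A (subst Occurs3-12 (sym (List.concat-map cs)) (occurs-map⁺ mono (concat cs) occ)))
    (trans (sym (List.length-map (map r) cs)) (size A)))

InRange-suc⁻ : ∀ {n x} → InRange (suc n) x → InRange n x ⊎ x ≡ suc n
InRange-suc⁻ (1≤x , x≤1+n) with m≤n⇒m<n∨m≡n x≤1+n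
... | inj₁ (s≤s x≤n) = inj₁ (1≤x , x≤n)
... | inj₂ x≡1+n     = inj₂ x≡1+n

InRange-weaken : ∀ {n x} → InRange n x → InRange (suc n) x
InRange-weaken (1≤x , x≤n) = 1≤x , m≤n⇒m≤1+n x≤n

InRange-top : ∀ n → InRange (suc n) (suc n)
InRange-top n = s≤s z≤n , ≤-refl

InRange-∪-top : ∀ n → InRange n ∪ ｛ suc n ｝ ≐ InRange (suc n)
InRange-∪-top n = [ InRange-weaken , (λ { refl → InRange-top n }) ]′ ,
  λ x∈ → [ inj₁ , inj₂ ∘ sym ]′ (InRange-suc⁻ x∈)

InRange-∩-top : ∀ n → InRange (suc n) ∩ ∁ ｛ suc n ｝ ≐ InRange n
InRange-∩-top n = (λ (x∈ , x≢) → [ (λ x∈′ → x∈′) , (λ x≡ → ⊥-elim (x≢ (sym x≡))) ]′ (InRange-suc⁻ x∈)) ,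
  λ x∈ → InRange-weaken x∈ , λ { refl → <-irrefl refl (proj₂ x∈) }

∩∁∪-cancel : ∀ {S : ℕ → Set} {x} → S x → (S ∩ ∁ ｛ x ｝) ∪ ｛ x ｝ ≐ S
∩∁∪-cancel {x = x} x∈S = [ proj₁ , (λ { refl → x∈S }) ]′ ,
  λ {y} y∈S → case x ≟ y of λ { (yes x≡y) → inj₂ x≡y ; (no x≢y) → inj₁ (y∈S , x≢y) }

InRange-∪-top2 : ∀ m → InRange m ∪ ｛ suc m ｝ ∪ ｛ suc (suc m) ｝ ≐ InRange (suc (suc m))
InRange-∪-top2 m = [ InRange-weaken ∘ InRange-weaken , [ (λ { refl → InRange-weaken (InRange-top m) }) , (λ { refl → InRange-top (suc m) }) ]′ ]′ ,
  λ x∈ → [ (λ x∈′ → [ inj₁ , inj₂ ∘ inj₁ ∘ sym ]′ (InRange-suc⁻ x∈′)) , inj₂ ∘ inj₂ ∘ sym ]′ (InRange-suc⁻ x∈)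

InRange-∩-top2 : ∀ m → InRange (suc (suc m)) ∩ ∁ ｛ suc m ｝ ∩ ∁ ｛ suc (suc m) ｝ ≐ InRange m
InRange-∩-top2 m = (λ (x∈ , x≢1+m , x≢2+m) → proj₁ (InRange-∩-top m) (proj₁ (InRange-∩-top (suc m)) (x∈ , x≢2+m) , x≢1+m)) ,
  λ x∈ → InRange-weaken (InRange-weaken x∈) , (λ { refl → <-irrefl refl (proj₂ x∈) }) ,
         (λ { refl → <-irrefl refl (m≤n⇒m≤1+n (proj₂ x∈)) })

InRange-move : ∀ {N i} → InRange N i → (InRange N ∩ ∁ ｛ i ｝) ∪ ｛ i ｝ ∪ ｛ suc N ｝ ≐ InRange (suc N)
InRange-move {N} {i} i∈ =
  [ InRange-weaken ∘ proj₁ , [ (λ { refl → InRange-weaken i∈ }) , (λ { refl → InRange-top N }) ]′ ]′ ,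
  λ x∈ → [ (λ x∈′ → [ inj₁ , inj₂ ∘ inj₁ ]′ (proj₂ (∩∁∪-cancel i∈) x∈′)) , inj₂ ∘ inj₂ ∘ sym ]′ (InRange-suc⁻ x∈)

InRange-move⁻ : ∀ {N i} → InRange N i → (InRange (suc N) ∩ ∁ ｛ i ｝ ∩ ∁ ｛ suc N ｝) ∪ ｛ i ｝ ≐ InRange N
InRange-move⁻ {N} {i} i∈ =
  [ (λ (x∈ , i≢x , top≢x) → proj₁ (InRange-∩-top N) (x∈ , top≢x)) , (λ { refl → i∈ }) ]′ ,
  λ x∈ → [ (λ (x∈′ , i≢x) → inj₁ (InRange-weaken x∈′ , i≢x , λ { refl → <-irrefl refl (proj₂ x∈) })) , inj₂ ]′
           (proj₂ (∩∁∪-cancel i∈) x∈)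

punchIn : ℕ → ℕ → ℕ
punchIn j v = if v <ᵇ j then v else suc v

punchOut : ℕ → ℕ → ℕ
punchOut j v = if v ≤ᵇ j then v else v ∸ 1

punchIn-< : ∀ {j v} → v < j → punchIn j v ≡ v
punchIn-< v<j rewrite T-true (<⇒<ᵇ v<j) = refl

punchIn-≥ : ∀ {j v} → j ≤ v → punchIn j v ≡ suc v
punchIn-≥ {j} {v} j≤v rewrite T-false {v <ᵇ j} (λ t → <⇒≱ (<ᵇ⇒< v j t) j≤v) = refl

punchOut-≤ : ∀ {j v} → v ≤ j → punchOut j v ≡ v
punchOut-≤ v≤j rewrite T-true (≤⇒≤ᵇ v≤j) = refl

punchOut-> : ∀ {j v} → j < v → punchOut j v ≡ v ∸ 1
punchOut-> {j} {v} j<v rewrite T-false {v ≤ᵇ j} (λ t → <⇒≱ j<v (≤ᵇ⇒≤ v j t)) = refl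

punchIn-mono : ∀ j → StrictlyMonotone (punchIn j)
punchIn-mono j {a} {b} a<b with <-cmp a j | <-cmp b j
... | tri< a<j _ _ | tri< b<j _ _ = subst₂ _<_ (sym (punchIn-< a<j)) (sym (punchIn-< b<j)) a<b
... | tri< a<j _ _ | tri≈ _ b≡j _ = subst₂ _<_ (sym (punchIn-< a<j)) (sym (punchIn-≥ (≤-reflexive (sym b≡j)))) (m<n⇒m<1+n a<b)
... | tri< a<j _ _ | tri> _ _ j<b = subst₂ _<_ (sym (punchIn-< a<j)) (sym (punchIn-≥ (<⇒≤ j<b))) (m<n⇒m<1+n a<b)
... | tri≈ _ a≡j _ | _            = subst₂ _<_ (sym (punchIn-≥ (≤-reflexive (sym a≡j)))) (sym (punchIn-≥ (≤-trans (≤-reflexive (sym a≡j)) (<⇒≤ a<b)))) (s≤s a<b)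
... | tri> _ _ j<a | _            = subst₂ _<_ (sym (punchIn-≥ (<⇒≤ j<a))) (sym (punchIn-≥ (<⇒≤ (<-trans j<a a<b)))) (s≤s a<b)

punchIn≢ : ∀ j v → punchIn j v ≢ j
punchIn≢ j v eq with <-cmp v j
... | tri< v<j _ _ = <-irrefl (trans (sym (punchIn-< v<j)) eq) v<j
... | tri≈ _ v≡j _ = <-irrefl (sym (trans (sym (punchIn-≥ (≤-reflexive (sym v≡j)))) eq)) (subst (_< suc v) v≡j (n<1+n v))
... | tri> _ _ j<v = <-irrefl (sym (trans (sym (punchIn-≥ (<⇒≤ j<v))) eq)) (<-trans j<v (n<1+n v))

punchOut-punchIn : ∀ j v → punchOut j (punchIn j v) ≡ v
punchOut-punchIn j v with <-cmp v j
... | tri< v<j _ _ = trans (cong (punchOut j) (punchIn-< v<j)) (punchOut-≤ (<⇒≤ v<j))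
... | tri≈ _ v≡j _ = trans (cong (punchOut j) (punchIn-≥ (≤-reflexive (sym v≡j)))) (punchOut-> (s≤s (≤-reflexive (sym v≡j))))
... | tri> _ _ j<v = trans (cong (punchOut j) (punchIn-≥ (<⇒≤ j<v))) (punchOut-> (<-trans j<v (n<1+n v)))

punchIn-punchOut : ∀ j v → v ≢ j → punchIn j (punchOut j v) ≡ v
punchIn-punchOut j v v≢j with <-cmp v j
... | tri< v<j _ _ = trans (cong (punchIn j) (punchOut-≤ (<⇒≤ v<j))) (punchIn-< v<j)
... | tri≈ _ v≡j _ = ⊥-elim (v≢j v≡j)
... | tri> _ _ j<v = trans (cong (punchIn j) (punchOut-> j<v))
    (trans (punchIn-≥ (≤-pred (subst (j <_) (sym (m+[n∸m]≡n {1} (≤-trans (s≤s z≤n) j<v))) j<v))) (m+[n∸m]≡n {1} (≤-trans (s≤s z≤n) j<v)))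

punchOut-mono : ∀ {j a b} → a ≢ j → b ≢ j → a < b → punchOut j a < punchOut j b
punchOut-mono {j} {a} {b} a≢j b≢j a<b = StrictlyMonotone-reflects (punchIn-mono j)
  (subst₂ _<_ (sym (punchIn-punchOut j a a≢j)) (sym (punchIn-punchOut j b b≢j)) a<b)

punchIn-inRange : ∀ {N j v} → InRange N v → InRange (suc N) (punchIn j v)
punchIn-inRange {N} {j} {v} (1≤v , v≤N) with <-cmp v j
... | tri< v<j _ _ = subst (InRange (suc N)) (sym (punchIn-< v<j)) (1≤v , m≤n⇒m≤1+n v≤N)
... | tri≈ _ v≡j _ = subst (InRange (suc N)) (sym (punchIn-≥ (≤-reflexive (sym v≡j)))) (s≤s z≤n , s≤s v≤N)
... | tri> _ _ j<v = subst (InRange (suc N)) (sym (punchIn-≥ (<⇒≤ j<v))) (s≤s z≤n , s≤s v≤N)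

punchOut-inRange : ∀ {N j v} → InRange (suc N) j → InRange (suc N) v → v ≢ j → InRange N (punchOut j v)
punchOut-inRange {N} {j} {v} (1≤j , j≤1+N) (1≤v , v≤1+N) v≢j with <-cmp v j
... | tri< v<j _ _ = subst (InRange N) (sym (punchOut-≤ (<⇒≤ v<j))) (1≤v , ≤-pred (≤-trans v<j j≤1+N))
... | tri≈ _ v≡j _ = ⊥-elim (v≢j v≡j)
... | tri> _ _ j<v = subst (InRange N) (sym (punchOut-> j<v)) (≤-trans 1≤j (∸-monoˡ-≤ 1 j<v) , ∸-monoˡ-≤ 1 v≤1+N)

-- The bijections

-- LastCycleIs k i j: the cycle forms counted by the coefficient of y^k in z_{n,i,j}.

LastCycleIs : ℕ → ℕ → ℕ → List (List ℕ) → Set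
LastCycleIs k i j cs = Admissible k cs × headOr0 (lastCycle cs) ≡ i × lastOr0 (lastCycle cs) ≡ j

LastCycleEndIn : ℕ → ℕ → ℕ → ℕ → List (List ℕ) → Set
LastCycleEndIn k i a b cs = Admissible k cs × headOr0 (lastCycle cs) ≡ i × a ≤ lastOr0 (lastCycle cs) × lastOr0 (lastCycle cs) ≤ b

LastCycleHeadIn : ℕ → ℕ → ℕ → ℕ → List (List ℕ) → Set
LastCycleHeadIn k a b j cs = Admissible k cs × lastOr0 (lastCycle cs) ≡ j × a ≤ headOr0 (lastCycle cs) × headOr0 (lastCycle cs) ≤ b

module TopCycle (m k : ℕ) where
  top : List ℕ
  top = suc m ∷ suc (suc m) ∷ []

  below-top : ∀ {x} → InRange m x → x < suc m
  below-top = s≤s ∘ proj₂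

  to-valid : ∀ {cs} → StandardForm (InRange m) cs → Admissible k cs →
    StandardForm (InRange (suc (suc m))) (cs ∷ʳ top) × LastCycleIs (suc k) (suc m) (suc (suc m)) (cs ∷ʳ top)
  to-valid {cs} F A = LastCycleForm⇒StandardForm (LastCycleForm-resp (InRange-∪-top2 m)
      (LastCycleForm-new F (λ x∈ → <-irrefl refl (below-top x∈)) (λ x∈ → <-irrefl refl (m<n⇒m<1+n (below-top x∈)))
        (n<1+n _) heads<))
    , Admissible-new A avoids′ , cong headOr0 (lastCycle-∷ʳ cs top) , cong lastOr0 (lastCycle-∷ʳ cs top)
    where
    heads< : All (_< suc m) (map headOr0 cs)
    heads< = All.map⁺ (All.tabulate (λ c∈ → below-top (All.lookup (flat-sound F) (headOr0-∈-concat cs c∈ (All.lookup (nonempty F) c∈)))))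
    avoids′ : Avoids3-12 (concat cs ++ top)
    avoids′ = subst Avoids3-12 (List.++-assoc (concat cs) (suc m ∷ []) (suc (suc m) ∷ []))
      (avoids-∷ʳ-max _ _ (avoids-∷ʳ-max _ _ (avoids A) (All.map below-top (flat-sound F)))
        (All.∷ʳ⁺ (All.map (m<n⇒m<1+n ∘ below-top) (flat-sound F)) ≤-refl))

  last-is-top : ∀ {pre L} → LastCycleForm (InRange (suc (suc m))) pre L → headOr0 L ≡ suc m → lastOr0 L ≡ suc (suc m) → L ≡ top
  last-is-top {pre} {L} F head≡ last≡ = pair-shape L head≡ last≡ (λ eq → <-irrefl eq (n<1+n _))
    (subst (length L ≤_) (trans (fromTo-length (suc m) (suc (suc m))) (m+n∸n≡m 2 m))
      (Unique-⊆⇒length≤ (Unique-++⁻ʳ (concat pre) (all-unique F)) (λ x∈ →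
        fromTo-∈⁺ (subst (_≤ _) head≡ (All.lookup (last-head-minimal F) x∈))
          (proj₂ (All.lookup (all-sound F) (∈-++⁺ʳ (concat pre) x∈))))))

  top-view : ∀ {cs} → StandardForm (InRange (suc (suc m))) cs → LastCycleIs (suc k) (suc m) (suc (suc m)) cs →
    ∃ λ pre → cs ≡ pre ∷ʳ top
  top-view {cs} F (_ , head≡ , last≡) with lastCycle-split cs (subst (1 ≤_) (sym head≡) (s≤s z≤n))
  ... | pre , L , refl =
    pre , cong (pre ∷ʳ_) (last-is-top (StandardForm⇒LastCycleForm pre L F) (lastCycle-head pre L head≡) (lastCycle-last pre L last≡))

  from-valid : ∀ {cs} → StandardForm (InRange (suc (suc m))) cs → LastCycleIs (suc k) (suc m) (suc (suc m)) cs →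
    StandardForm (InRange m) (initL cs) × Admissible k (initL cs)
  from-valid F Z with top-view F Z
  ... | pre , refl rewrite initL-∷ʳ pre top =
    StandardForm-resp (InRange-∩-top2 m) (LastCycleForm-remove (StandardForm⇒LastCycleForm pre top F)) , Admissible-remove (proj₁ Z)

  to∘from : ∀ {cs} → StandardForm (InRange (suc (suc m))) cs → LastCycleIs (suc k) (suc m) (suc (suc m)) cs → initL cs ∷ʳ top ≡ cs
  to∘from F Z with top-view F Z
  ... | pre , refl = cong (_∷ʳ top) (initL-∷ʳ pre top)

  bijection : CycleFormBijection m (Admissible k) (suc (suc m)) (LastCycleIs (suc k) (suc m) (suc (suc m)))
  bijection = record
    { to = λ cs → cs ∷ʳ top
    ; from = initL
    ; to-valid = to-valid
    ; from-valid = from-valid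
    ; from∘to = λ {cs} _ _ → initL-∷ʳ cs top
    ; to∘from = to∘from
    }

module ExtendLastCycle (N k i : ℕ) (1≤i : 1 ≤ i) where
  x : ℕ
  x = suc N

  to-valid : ∀ {cs} → StandardForm (InRange N) cs → LastCycleEndIn k i (suc i) N cs →
    StandardForm (InRange x) (mapLast (_∷ʳ x) cs) × LastCycleIs k i x (mapLast (_∷ʳ x) cs) × 2 < length (lastCycle (mapLast (_∷ʳ x) cs))
  to-valid {cs} F (A , head≡ , i<last , last≤N) with lastCycle-split cs (subst (1 ≤_) (sym head≡) 1≤i)
  ... | pre , L , refl rewrite mapLast-∷ʳ (_∷ʳ x) pre L | lastCycle-∷ʳ pre (L ∷ʳ x) =
    LastCycleForm⇒StandardForm (LastCycleForm-resp (InRange-∪-top N)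
      (LastCycleForm-extend LF (λ x∈ → <-irrefl refl (proj₂ x∈)) (m≤n⇒m≤1+n (≤-trans (<⇒≤ (subst (_< _) (sym head≡L) i<last′)) last≤N′))))
    , (Admissible-extend A (last-nonempty LF) (avoids-∷ʳ-max _ x (avoids A) (All.map (s≤s ∘ proj₂) (flat-sound F)))
       , trans (headOr0-∷ʳ L x (last-nonempty LF)) head≡L , lastOr0-∷ʳ L x)
    , subst (2 <_) (sym (length-∷ʳ L x)) (s≤s (head≢last⇒Long L (λ eq → <-irrefl (trans (sym head≡L) eq) i<last′)))
    where
    LF : LastCycleForm (InRange N) pre L
    LF = StandardForm⇒LastCycleForm pre L F
    head≡L : headOr0 L ≡ i
    head≡L = lastCycle-head pre L head≡
    i<last′ : i < lastOr0 L
    i<last′ = subst (suc i ≤_) (cong lastOr0 (lastCycle-∷ʳ pre L)) i<last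
    last≤N′ : lastOr0 L ≤ N
    last≤N′ = subst (_≤ N) (cong lastOr0 (lastCycle-∷ʳ pre L)) last≤N

  from-view : ∀ {cs} → LastCycleIs k i x cs → ∃ λ pre → ∃ λ M → cs ≡ pre ∷ʳ (M ∷ʳ x)
  from-view {cs} (_ , head≡ , last≡) with lastCycle-split cs (subst (1 ≤_) (sym head≡) 1≤i)
  ... | pre , L , refl with last-split L (subst (1 ≤_) (sym (lastCycle-last pre L last≡)) (s≤s z≤n))
  ...   | M , L≡ = pre , M , cong (pre ∷ʳ_) (trans L≡ (cong (M ∷ʳ_) (lastCycle-last pre L last≡)))

  from-valid : ∀ {cs} → StandardForm (InRange x) cs → LastCycleIs k i x cs × 2 < length (lastCycle cs) →
    StandardForm (InRange N) (mapLast initL cs) × LastCycleEndIn k i (suc i) N (mapLast initL cs)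
  from-valid F (Z , 2<len) with from-view Z
  ... | pre , M , refl rewrite mapLast-∷ʳ initL pre (M ∷ʳ x) | initL-∷ʳ M x | lastCycle-∷ʳ pre M | lastCycle-∷ʳ pre (M ∷ʳ x) =
    LastCycleForm⇒StandardForm LF′ , Admissible-shrink (proj₁ Z) long
    , head≡M
    , ≤∧≢⇒< (subst (_≤ _) head≡M (All.lookup (last-head-minimal LF′) (lastOr0-∈ M (last-nonempty LF′))))
        (λ eq → Unique-Long⇒head≢last M (Unique-++⁻ʳ _ (all-unique LF′)) long (trans head≡M eq))
    , proj₂ (All.lookup (all-sound LF′) (∈-++⁺ʳ _ (lastOr0-∈ M (last-nonempty LF′))))
    where
    long : Long M
    long = ≤-pred (subst (2 <_) (length-∷ʳ M x) 2<len)
    LF′ : LastCycleForm (InRange N) pre M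
    LF′ = LastCycleForm-resp (InRange-∩-top N) (LastCycleForm-shrink (StandardForm⇒LastCycleForm pre (M ∷ʳ x) F) (≤-trans (s≤s z≤n) long))
    head≡M : headOr0 M ≡ i
    head≡M = trans (sym (headOr0-∷ʳ M x (≤-trans (s≤s z≤n) long))) (proj₁ (proj₂ Z))

  from∘to : ∀ {cs} → StandardForm (InRange N) cs → LastCycleEndIn k i (suc i) N cs → mapLast initL (mapLast (_∷ʳ x) cs) ≡ cs
  from∘to {cs} F (_ , head≡ , _) with lastCycle-split cs (subst (1 ≤_) (sym head≡) 1≤i)
  ... | pre , L , refl rewrite mapLast-∷ʳ (_∷ʳ x) pre L | mapLast-∷ʳ initL pre (L ∷ʳ x) = cong (pre ∷ʳ_) (initL-∷ʳ L x)

  to∘from : ∀ {cs} → StandardForm (InRange x) cs → LastCycleIs k i x cs × 2 < length (lastCycle cs) → mapLast (_∷ʳ x) (mapLast initL cs) ≡ cs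
  to∘from F (Z , _) with from-view Z
  ... | pre , M , refl rewrite mapLast-∷ʳ initL pre (M ∷ʳ x) | initL-∷ʳ M x = mapLast-∷ʳ (_∷ʳ x) pre M

  bijection : CycleFormBijection N (LastCycleEndIn k i (suc i) N) (suc N)
    (λ cs → LastCycleIs k i (suc N) cs × 2 < length (lastCycle cs))
  bijection = record
    { to = mapLast (_∷ʳ suc N)
    ; from = mapLast initL
    ; to-valid = to-valid
    ; from-valid = from-valid
    ; from∘to = from∘to
    ; to∘from = to∘from
    }

module MoveToNewCycle (N k i : ℕ) (1≤i : 1 ≤ i) (i<N : i < N) where
  x : ℕ
  x = suc N

  pair : List ℕ
  pair = i ∷ x ∷ []

  i∈ : InRange N i
  i∈ = 1≤i , <⇒≤ i<N

  to : List (List ℕ) → List (List ℕ)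
  to cs = mapLast initL cs ∷ʳ pair

  from : List (List ℕ) → List (List ℕ)
  from cs = mapLast (_∷ʳ i) (initL cs)

  to-view : ∀ {cs} → LastCycleHeadIn k 1 (i ∸ 1) i cs → ∃ λ pre → ∃ λ M → cs ≡ pre ∷ʳ (M ∷ʳ i) × headOr0 M < i × 1 ≤ length M
  to-view {cs} (_ , last≡ , 1≤head , head≤) with lastCycle-split cs 1≤head
  ... | pre , L , refl with last-split L (subst (1 ≤_) (sym (lastCycle-last pre L last≡)) 1≤i)
  ...   | M , L≡ rewrite lastCycle-last pre L last≡ | L≡ | lastCycle-∷ʳ pre (M ∷ʳ i) with M
  ...     | []    = ⊥-elim (<-irrefl refl (≤-trans (s≤s head≤) (≤-reflexive (m+[n∸m]≡n 1≤i))))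
  ...     | m ∷ M′ = pre , m ∷ M′ , refl , ≤-trans (s≤s head≤) (≤-reflexive (m+[n∸m]≡n 1≤i)) , s≤s z≤n

  to-valid : ∀ {cs} → StandardForm (InRange N) cs → LastCycleHeadIn k 1 (i ∸ 1) i cs →
    StandardForm (InRange x) (to cs) × LastCycleIs (suc k) i x (to cs) × ¬ (2 < length (lastCycle (to cs)))
  to-valid F H with to-view H
  ... | pre , M , refl , head<i , 1≤len
    rewrite mapLast-∷ʳ initL pre (M ∷ʳ i) | initL-∷ʳ M i | lastCycle-∷ʳ (pre ∷ʳ M) pair =
    LastCycleForm⇒StandardForm (LastCycleForm-resp (InRange-move i∈)
      (LastCycleForm-new (LastCycleForm⇒StandardForm LF′) (λ (_ , i≢i) → i≢i refl) (λ x∈ → <-irrefl refl (proj₂ (proj₁ x∈)))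
        (m<n⇒m<1+n i<N) heads<i))
    , (Admissible-new (Admissible-shrink (proj₁ H) long) avoids′ , refl , refl)
    , λ { (s≤s (s≤s ())) }
    where
    LF : LastCycleForm (InRange N) pre (M ∷ʳ i)
    LF = StandardForm⇒LastCycleForm pre (M ∷ʳ i) F
    LF′ : LastCycleForm (InRange N ∩ ∁ ｛ i ｝) pre M
    LF′ = LastCycleForm-shrink LF 1≤len
    u : List ℕ
    u = concat (pre ∷ʳ M)
    word≡ : concat (pre ∷ʳ (M ∷ʳ i)) ≡ u ∷ʳ i
    word≡ = concat-∷ʳ-∷ʳ pre M i
    N∈u : N ∈ u
    N∈u with ∈-∷ʳ⁻ u i (subst (N ∈_) word≡ (flat-complete F (≤-trans (s≤s z≤n) i<N , ≤-refl)))
    ... | inj₁ N∈ = N∈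
    ... | inj₂ N≡i = ⊥-elim (<-irrefl (sym N≡i) i<N)
    -- This is where i < N is needed: if M were (ℓ), then N, ℓ, i would be an occurrence of 3-12.
    long : Long M
    long = head≢last⇒Long M (λ eq → <-irrefl refl (<-≤-trans head<i (subst (i ≤_) (trans (lastOr0≡last) (sym eq))
      (avoids-∷ʳ⇒≤last u i (subst Avoids3-12 word≡ (avoids (proj₁ H))) N∈u i<N))))
      where
      lastOr0≡last : lastOr0 u ≡ lastOr0 M
      lastOr0≡last = trans (cong lastOr0 (concat-∷ʳ pre M)) (lastOr0-++ (concat pre) M 1≤len)
    heads<i : All (_< i) (map headOr0 (pre ∷ʳ M))
    heads<i = subst (All (_< i)) (sym (List.map-++ headOr0 pre (M ∷ []))) (All.∷ʳ⁺ (All.map (λ h< → <-trans h< head<i)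
      (pre-heads-below LF′)) head<i)
    avoids′ : Avoids3-12 (u ++ pair)
    avoids′ = subst Avoids3-12 (trans (sym (concat-∷ʳ-pair pre M i x)) (concat-∷ʳ (pre ∷ʳ M) pair))
      (avoids-∷ʳ-max _ x (avoids (proj₁ H)) (All.map (s≤s ∘ proj₂) (flat-sound F)))

  from-view : ∀ {cs} → StandardForm (InRange x) cs → LastCycleIs (suc k) i x cs × ¬ (2 < length (lastCycle cs)) →
    ∃ λ pre → ∃ λ M → cs ≡ (pre ∷ʳ M) ∷ʳ pair
  from-view {cs} F ((_ , head≡ , last≡) , short) with lastCycle-split cs (subst (1 ≤_) (sym head≡) 1≤i)
  ... | pre′ , L , refl with pair-shape L (lastCycle-head pre′ L head≡) (lastCycle-last pre′ L last≡)
          (λ eq → <-irrefl eq (m<n⇒m<1+n i<N)) (≮⇒≥ (subst (λ c → ¬ (2 < length c)) (lastCycle-∷ʳ pre′ L) short))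
  ...   | refl with pre′ | flat-complete F (≤-trans (s≤s z≤n) i<N , n≤1+n N)
  ...     | [] | here N≡i = ⊥-elim (<-irrefl (sym N≡i) i<N)
  ...     | [] | there (here N≡x) = ⊥-elim (<-irrefl N≡x (n<1+n N))
  ...     | c ∷ cs′ | _ with ∷ʳ-view (c ∷ cs′) (s≤s z≤n)
  ...       | pre , M , eq = pre , M , cong (_∷ʳ pair) eq

  from-valid : ∀ {cs} → StandardForm (InRange x) cs → LastCycleIs (suc k) i x cs × ¬ (2 < length (lastCycle cs)) →
    StandardForm (InRange N) (from cs) × LastCycleHeadIn k 1 (i ∸ 1) i (from cs)
  from-valid F Z with from-view F Z
  ... | pre , M , refl rewrite initL-∷ʳ (pre ∷ʳ M) pair | mapLast-∷ʳ (_∷ʳ i) pre M | lastCycle-∷ʳ pre (M ∷ʳ i) =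
    LastCycleForm⇒StandardForm (LastCycleForm-resp (InRange-move⁻ i∈) (LastCycleForm-extend LF′ (λ (_ , i≢i , _) → i≢i refl) (<⇒≤ head<i)))
    , Admissible-extend (Admissible-remove (proj₁ (proj₁ Z))) 1≤len
        (subst Avoids3-12 (concat-∷ʳ-∷ʳ pre M i) (avoids-++⁻ (concat (pre ∷ʳ (M ∷ʳ i))) (x ∷ []) (subst Avoids3-12 (concat-∷ʳ-pair pre M i x) (avoids (proj₁ (proj₁ Z))))))
    , lastOr0-∷ʳ M i
    , subst (1 ≤_) (sym head≡) (proj₁ (proj₁ (All.lookup (all-sound LF′) (∈-++⁺ʳ (concat pre) (headOr0-∈ 1≤len)))))
    , subst (_≤ i ∸ 1) (sym head≡) (≤-pred (≤-trans head<i (≤-reflexive (sym (m+[n∸m]≡n 1≤i)))))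
    where
    LF : LastCycleForm (InRange x) (pre ∷ʳ M) pair
    LF = StandardForm⇒LastCycleForm (pre ∷ʳ M) pair F
    LF′ : LastCycleForm (InRange x ∩ ∁ ｛ i ｝ ∩ ∁ ｛ x ｝) pre M
    LF′ = StandardForm⇒LastCycleForm pre M (LastCycleForm-remove LF)
    1≤len : 1 ≤ length M
    1≤len = last-nonempty LF′
    head<i : headOr0 M < i
    head<i = proj₂ (All.∷ʳ⁻ (subst (All (_< i)) (List.map-++ headOr0 pre (M ∷ [])) (pre-heads-below LF)))
    head≡ : headOr0 (M ∷ʳ i) ≡ headOr0 M
    head≡ = headOr0-∷ʳ M i 1≤len

  from∘to : ∀ {cs} → StandardForm (InRange N) cs → LastCycleHeadIn k 1 (i ∸ 1) i cs → from (to cs) ≡ cs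
  from∘to F H with to-view H
  ... | pre , M , refl , _ rewrite mapLast-∷ʳ initL pre (M ∷ʳ i) | initL-∷ʳ M i | initL-∷ʳ (pre ∷ʳ M) pair =
    mapLast-∷ʳ (_∷ʳ i) pre M

  to∘from : ∀ {cs} → StandardForm (InRange x) cs → LastCycleIs (suc k) i x cs × ¬ (2 < length (lastCycle cs)) → to (from cs) ≡ cs
  to∘from F Z with from-view F Z
  ... | pre , M , refl rewrite initL-∷ʳ (pre ∷ʳ M) pair | mapLast-∷ʳ (_∷ʳ i) pre M | mapLast-∷ʳ initL pre (M ∷ʳ i) | initL-∷ʳ M i = refl

  bijection : CycleFormBijection N (LastCycleHeadIn k 1 (i ∸ 1) i) (suc N)
    (λ cs → LastCycleIs (suc k) i (suc N) cs × ¬ (2 < length (lastCycle cs)))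
  bijection = record
    { to = to
    ; from = from
    ; to-valid = to-valid
    ; from-valid = from-valid
    ; from∘to = from∘to
    ; to∘from = to∘from
    }

module InsertIntoLastCycle (N k i j : ℕ) (1≤i : 1 ≤ i) (i<j : i < j) (j≤N : j ≤ N) where
  r r⁻ : ℕ → ℕ
  r  = punchIn j
  r⁻ = punchOut j

  to : List (List ℕ) → List (List ℕ)
  to cs = mapLast (_∷ʳ j) (map (map r) cs)

  from : List (List ℕ) → List (List ℕ)
  from cs = map (map r⁻) (mapLast initL cs)

  j∈ : InRange (suc N) j
  j∈ = ≤-trans (s≤s z≤n) (≤-trans 1≤i (<⇒≤ i<j)) , m≤n⇒m≤1+n j≤N

  Punctured : ℕ → Set
  Punctured = InRange (suc N) ∩ ∁ ｛ j ｝

  r-into : ∀ {v} → InRange N v → Punctured (r v)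
  r-into {v} v∈ = punchIn-inRange {j = j} v∈ , λ eq → punchIn≢ j v (sym eq)

  r⁻-into : ∀ {v} → Punctured v → InRange N (r⁻ v)
  r⁻-into (v∈ , j≢v) = punchOut-inRange j∈ v∈ (j≢v ∘ sym)

  to-valid : ∀ {cs} → StandardForm (InRange N) cs → LastCycleEndIn k i j N cs → StandardForm (InRange (suc N)) (to cs) × LastCycleIs k i j (to cs)
  to-valid {cs} F (A , head≡ , j≤last , last≤N) with lastCycle-split cs (subst (1 ≤_) (sym head≡) 1≤i)
  ... | pre , L , refl rewrite map-map-∷ʳ r pre L | mapLast-∷ʳ (_∷ʳ j) (map (map r) pre) (map r L)
                             | lastCycle-∷ʳ (map (map r) pre) (map r L ∷ʳ j) =
    LastCycleForm⇒StandardForm (LastCycleForm-resp (∩∁∪-cancel j∈)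
      (LastCycleForm-extend LF (λ (_ , j≢j) → j≢j refl) (subst (_≤ j) (sym headr≡) (<⇒≤ i<j))))
    , Admissible-extend A′ (last-nonempty LF)
        (avoids-∷ʳ-below-last (concat (map (map r) pre ∷ʳ map r L)) j (avoids A′) (subst (j <_) (sym last≡) (s≤s j≤last′)))
    , trans (headOr0-∷ʳ (map r L) j (last-nonempty LF)) headr≡ , lastOr0-∷ʳ (map r L) j
    where
    F′ : StandardForm Punctured (map (map r) pre ∷ʳ map r L)
    F′ = subst (StandardForm Punctured) (map-map-∷ʳ r pre L)
      (StandardForm-map r (λ _ _ → punchIn-mono j) r-into (λ {y} y∈ → r⁻ y , r⁻-into y∈ , punchIn-punchOut j y (proj₂ y∈ ∘ sym)) F)
    LF : LastCycleForm Punctured (map (map r) pre) (map r L)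
    LF = StandardForm⇒LastCycleForm (map (map r) pre) (map r L) F′
    L≠[] : 1 ≤ length L
    L≠[] = subst (1 ≤_) (List.length-map r L) (last-nonempty LF)
    headr≡ : headOr0 (map r L) ≡ i
    headr≡ = trans (headOr0-map r L L≠[]) (trans (cong r (lastCycle-head pre L head≡)) (punchIn-< i<j))
    j≤last′ : j ≤ lastOr0 L
    j≤last′ = subst (j ≤_) (cong lastOr0 (lastCycle-∷ʳ pre L)) j≤last
    A′ : Admissible k (map (map r) pre ∷ʳ map r L)
    A′ = subst (Admissible k) (map-map-∷ʳ r pre L) (Equivalence.to (Admissible-map r (punchIn-mono j)) A)
    last≡ : lastOr0 (concat (map (map r) pre ∷ʳ map r L)) ≡ suc (lastOr0 L)
    last≡ = begin
      lastOr0 (concat (map (map r) pre ∷ʳ map r L))   ≡⟨ cong lastOr0 (concat-∷ʳ (map (map r) pre) (map r L)) ⟩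
      lastOr0 (concat (map (map r) pre) ++ map r L)   ≡⟨ lastOr0-++ (concat (map (map r) pre)) (map r L) (last-nonempty LF) ⟩
      lastOr0 (map r L)                               ≡⟨ lastOr0-map r L L≠[] ⟩
      r (lastOr0 L)                                   ≡⟨ punchIn-≥ j≤last′ ⟩
      suc (lastOr0 L)                                 ∎
      where open ≡-Reasoning

  restore : ∀ {pre M} → StandardForm (InRange (suc N)) (pre ∷ʳ (M ∷ʳ j)) → map (map r) (map (map r⁻) (pre ∷ʳ M)) ≡ pre ∷ʳ M
  restore {pre} {M} F = map-map-inverse r⁻ r (pre ∷ʳ M) (λ {v} v∈ → punchIn-punchOut j v (λ { refl →
    Unique-++⇒disjoint (concat (pre ∷ʳ M)) (subst Unique (concat-∷ʳ-∷ʳ pre M j) (flat-unique F)) v∈ (here refl) }))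

  from-view : ∀ {cs} → LastCycleIs k i j cs → ∃ λ pre → ∃ λ M → cs ≡ pre ∷ʳ (M ∷ʳ j) × headOr0 M ≡ i × 1 ≤ length M
  from-view {cs} (_ , head≡ , last≡) with lastCycle-split cs (subst (1 ≤_) (sym head≡) 1≤i)
  ... | pre , L , refl with last-split L (subst (1 ≤_) (sym (lastCycle-last pre L last≡)) (proj₁ j∈))
  ...   | M , L≡ rewrite lastCycle-last pre L last≡ | L≡ | lastCycle-∷ʳ pre (M ∷ʳ j) with M
  ...     | []     = ⊥-elim (<-irrefl (sym head≡) i<j)
  ...     | m ∷ M′ = pre , m ∷ M′ , refl , head≡ , s≤s z≤n

  from-valid : ∀ {cs} → StandardForm (InRange (suc N)) cs → LastCycleIs k i j cs → StandardForm (InRange N) (from cs) × LastCycleEndIn k i j N (from cs)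
  from-valid F Z with from-view Z
  ... | pre , M , refl , head≡ , 1≤len rewrite mapLast-∷ʳ initL pre (M ∷ʳ j) | initL-∷ʳ M j | map-map-∷ʳ r⁻ pre M
                                            | lastCycle-∷ʳ (map (map r⁻) pre) (map r⁻ M) =
    subst (StandardForm (InRange N)) (map-map-∷ʳ r⁻ pre M)
      (StandardForm-map r⁻ (λ v∈ w∈ → punchOut-mono (proj₂ v∈ ∘ sym) (proj₂ w∈ ∘ sym)) r⁻-into
        (λ {y} y∈ → r y , r-into y∈ , punchOut-punchIn j y) (LastCycleForm⇒StandardForm LF′))
    , subst (Admissible k) (map-map-∷ʳ r⁻ pre M)
        (Equivalence.from (Admissible-map r (punchIn-mono j)) (subst (Admissible k) (sym (restore F)) (Admissible-shrink (proj₁ Z) long)))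
    , trans (headOr0-map r⁻ M 1≤len) (trans (cong r⁻ head≡) (punchOut-≤ (<⇒≤ i<j)))
    , subst (j ≤_) (sym last≡) (≤-pred (≤-trans j<last (≤-reflexive (sym (m+[n∸m]≡n {1} (≤-trans (s≤s z≤n) j<last))))))
    , subst (_≤ N) (sym last≡) (∸-monoˡ-≤ 1 (proj₂ (proj₁ (All.lookup (all-sound LF′) (∈-++⁺ʳ (concat pre) (lastOr0-∈ M 1≤len))))))
    where
    LF′ : LastCycleForm Punctured pre M
    LF′ = LastCycleForm-shrink (StandardForm⇒LastCycleForm pre (M ∷ʳ j) F) 1≤len
    u : List ℕ
    u = concat (pre ∷ʳ M)
    top∈u : suc N ∈ u
    top∈u = subst (_ ∈_) (sym (concat-∷ʳ pre M)) (all-complete LF′ (InRange-top N , λ eq → <-irrefl eq (s≤s j≤N)))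
    lastu≡ : lastOr0 u ≡ lastOr0 M
    lastu≡ = trans (cong lastOr0 (concat-∷ʳ pre M)) (lastOr0-++ (concat pre) M 1≤len)
    j<last : j < lastOr0 M
    j<last = ≤∧≢⇒< (subst (j ≤_) lastu≡ (avoids-∷ʳ⇒≤last u j (subst Avoids3-12 (concat-∷ʳ-∷ʳ pre M j) (avoids (proj₁ Z))) top∈u (s≤s j≤N)))
      (proj₂ (All.lookup (all-sound LF′) (∈-++⁺ʳ (concat pre) (lastOr0-∈ M 1≤len))))
    long : Long M
    long = head≢last⇒Long M (λ eq → <-irrefl (trans (sym head≡) eq) (<-trans i<j j<last))
    last≡ : lastOr0 (map r⁻ M) ≡ lastOr0 M ∸ 1
    last≡ = trans (lastOr0-map r⁻ M 1≤len) (punchOut-> j<last)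

  from∘to : ∀ {cs} → StandardForm (InRange N) cs → LastCycleEndIn k i j N cs → from (to cs) ≡ cs
  from∘to {cs} F (_ , head≡ , _) with lastCycle-split cs (subst (1 ≤_) (sym head≡) 1≤i)
  ... | pre , L , refl rewrite map-map-∷ʳ r pre L | mapLast-∷ʳ (_∷ʳ j) (map (map r) pre) (map r L)
                             | mapLast-∷ʳ initL (map (map r) pre) (map r L ∷ʳ j) | initL-∷ʳ (map r L) j =
    trans (cong (map (map r⁻)) (sym (map-map-∷ʳ r pre L))) (map-map-inverse r r⁻ (pre ∷ʳ L) (λ {v} _ → punchOut-punchIn j v))

  to∘from : ∀ {cs} → StandardForm (InRange (suc N)) cs → LastCycleIs k i j cs → to (from cs) ≡ cs
  to∘from F Z with from-view Z
  ... | pre , M , refl , _ , _ rewrite mapLast-∷ʳ initL pre (M ∷ʳ j) | initL-∷ʳ M j =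
    trans (cong (mapLast (_∷ʳ j)) (restore F)) (mapLast-∷ʳ (_∷ʳ j) pre M)

  bijection : CycleFormBijection N (LastCycleEndIn k i j N) (suc N) (LastCycleIs k i j)
  bijection = record
    { to = to
    ; from = from
    ; to-valid = to-valid
    ; from-valid = from-valid
    ; from∘to = from∘to
    ; to∘from = to∘from
    }

T-∧-⇔ : ∀ {a b} {A B : Set} → T a ⇔ A → T b ⇔ B → T (a ∧ b) ⇔ (A × B)
T-∧-⇔ a⇔ b⇔ = ⇔-trans T-∧ (a⇔ ×-⇔ b⇔)

T-≡ᵇ⇔ : ∀ {m n} → T (m ≡ᵇ n) ⇔ m ≡ n
T-≡ᵇ⇔ = mk⇔ (≡ᵇ⇒≡ _ _) (≡⇒≡ᵇ _ _)

T-inRangeᵇ⇔ : ∀ {a b v} → T (inRangeᵇ a b v) ⇔ (a ≤ v × v ≤ b)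
T-inRangeᵇ⇔ = mk⇔ T-inRangeᵇ⁻ (λ (a≤v , v≤b) → T-inRangeᵇ⁺ a≤v v≤b)

T-<ᵇ⇔ : ∀ {m n} → T (m <ᵇ n) ⇔ m < n
T-<ᵇ⇔ = mk⇔ (<ᵇ⇒< _ _) <⇒<ᵇ

T-not⇔ : ∀ {a} {A : Set} → T a ⇔ A → T (not a) ⇔ (¬ A)
T-not⇔ a⇔ = mk⇔ (λ t → T-not⁻ t ∘ Equivalence.from a⇔) (λ ¬A → T-not (¬A ∘ Equivalence.to a⇔))

module _ {n w} (P : Perm n w) where

  admissible⇔ : ∀ {k} → T (inD3-12 w ∧ (μ w ≡ᵇ k)) ⇔ Admissible k (cycles w)
  admissible⇔ {k} = ⇔-trans (T-∧-⇔ (T-∧-⇔ (isDerangement⇔ P (cycles-cycleForm P)) (T-not⇔ (contains3-12⇔ (flat w)))) T-≡ᵇ⇔)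
    (mk⇔ (λ ((long , avoids) , size) → mkAdmissible long avoids size)
         (λ A → (all-long A , avoids A) , size A))

  admissible-∧⇔ : ∀ {k b} {X : Set} → T b ⇔ X → T ((inD3-12 w ∧ (μ w ≡ᵇ k)) ∧ b) ⇔ (Admissible k (cycles w) × X)
  admissible-∧⇔ = T-∧-⇔ admissible⇔

  lastCycleIs⇔ : ∀ {k i j} → T (inD3-12 w ∧ (μ w ≡ᵇ k) ∧ (headOr0 (lastCycle (cycles w)) ≡ᵇ i) ∧ (lastOr0 (lastCycle (cycles w)) ≡ᵇ j))
    ⇔ LastCycleIs k i j (cycles w)
  lastCycleIs⇔ {k} {i} {j} = subst (λ b → T b ⇔ LastCycleIs k i j (cycles w))
    (∧-assoc (inD3-12 w) (μ w ≡ᵇ k) ((headOr0 (lastCycle (cycles w)) ≡ᵇ i) ∧ (lastOr0 (lastCycle (cycles w)) ≡ᵇ j)))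
    (admissible-∧⇔ (T-∧-⇔ T-≡ᵇ⇔ T-≡ᵇ⇔))

lastCycleHead lastCycleEnd : List ℕ → ℕ
lastCycleHead w = headOr0 (lastCycle (cycles w))
lastCycleEnd  w = lastOr0 (lastCycle (cycles w))

∧-regroup : ∀ x y z e → x ∧ (y ∧ (z ∧ e)) ≡ ((x ∧ y) ∧ z) ∧ e
∧-regroup x y z e = sym (trans (∧-assoc (x ∧ y) z e) (∧-assoc x y (z ∧ e)))

sum-zij-over-end : ∀ N i a b k → ΣP a b (λ ℓ → zij N i ℓ) k ≡
  count (λ w → (inD3-12 w ∧ (μ w ≡ᵇ k)) ∧ ((lastCycleHead w ≡ᵇ i) ∧ inRangeᵇ a b (lastCycleEnd w))) (perms N)
sum-zij-over-end N i a b k = begin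
  sum (map (λ ℓ → zij N i ℓ k) (fromTo a b))
    ≡⟨ sum-map-cong (fromTo a b) (λ ℓ → count-cong _ _ (perms N) (λ {w} _ → ∧-regroup (inD3-12 w) _ _ _)) ⟩
  sum (map (λ ℓ → count (λ w → p w ∧ (lastCycleEnd w ≡ᵇ ℓ)) (perms N)) (fromTo a b))
    ≡⟨ sum-count-fromTo p lastCycleEnd a b (perms N) ⟩
  count (λ w → p w ∧ inRangeᵇ a b (lastCycleEnd w)) (perms N)
    ≡⟨ count-cong _ _ (perms N) (λ {w} _ → ∧-assoc (inD3-12 w ∧ (μ w ≡ᵇ k)) _ _) ⟩
  count (λ w → (inD3-12 w ∧ (μ w ≡ᵇ k)) ∧ ((lastCycleHead w ≡ᵇ i) ∧ inRangeᵇ a b (lastCycleEnd w))) (perms N) ∎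
  where
  open ≡-Reasoning
  p : List ℕ → Bool
  p w = (inD3-12 w ∧ (μ w ≡ᵇ k)) ∧ (lastCycleHead w ≡ᵇ i)

sum-zij-over-head : ∀ N j a b k → ΣP a b (λ ℓ → zij N ℓ j) k ≡
  count (λ w → (inD3-12 w ∧ (μ w ≡ᵇ k)) ∧ ((lastCycleEnd w ≡ᵇ j) ∧ inRangeᵇ a b (lastCycleHead w))) (perms N)
sum-zij-over-head N j a b k = begin
  sum (map (λ ℓ → zij N ℓ j k) (fromTo a b))
    ≡⟨ sum-map-cong (fromTo a b) (λ ℓ → count-cong _ _ (perms N) (λ {w} _ →
         trans (cong (λ e → inD3-12 w ∧ ((μ w ≡ᵇ k) ∧ e)) (∧-comm (lastCycleHead w ≡ᵇ ℓ) _)) (∧-regroup (inD3-12 w) _ _ _))) ⟩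
  sum (map (λ ℓ → count (λ w → p w ∧ (lastCycleHead w ≡ᵇ ℓ)) (perms N)) (fromTo a b))
    ≡⟨ sum-count-fromTo p lastCycleHead a b (perms N) ⟩
  count (λ w → p w ∧ inRangeᵇ a b (lastCycleHead w)) (perms N)
    ≡⟨ count-cong _ _ (perms N) (λ {w} _ → ∧-assoc (inD3-12 w ∧ (μ w ≡ᵇ k)) _ _) ⟩
  count (λ w → (inD3-12 w ∧ (μ w ≡ᵇ k)) ∧ ((lastCycleEnd w ≡ᵇ j) ∧ inRangeᵇ a b (lastCycleHead w))) (perms N) ∎
  where
  open ≡-Reasoning
  p : List ℕ → Bool
  p w = (inD3-12 w ∧ (μ w ≡ᵇ k)) ∧ (lastCycleEnd w ≡ᵇ j)

LastCycleIs-zero : ∀ {i j} cs → 1 ≤ i → ¬ LastCycleIs 0 i j cs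
LastCycleIs-zero [] () (_ , refl , _)

zij-j<n : ∀ N i j → 1 ≤ i → i < j → j ≤ N → zij (suc N) i j ≈P ΣP j N (λ ℓ → zij N i ℓ)
zij-j<n N i j 1≤i i<j j≤N k = sym (trans (sum-zij-over-end N i j N k)
  (count-transfer (InsertIntoLastCycle.bijection N k i j 1≤i i<j j≤N) (λ P → admissible-∧⇔ P (T-∧-⇔ T-≡ᵇ⇔ T-inRangeᵇ⇔)) (λ P → lastCycleIs⇔ P)))

zij-j≡n : ∀ N i → 1 ≤ i → i < N →
  zij (suc N) i (suc N) ≈P ΣP (suc i) N (λ ℓ → zij N i ℓ) +P y* ΣP 1 (i ∸ 1) (λ ℓ → zij N ℓ i)
zij-j≡n N i 1≤i i<N k = trans (count-split (zpred k) long-last (perms (suc N))) (cong₂ _+_ (long k) (short k))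
  where
  zpred : ℕ → List ℕ → Bool
  zpred k w = inD3-12 w ∧ (μ w ≡ᵇ k) ∧ (lastCycleHead w ≡ᵇ i) ∧ (lastCycleEnd w ≡ᵇ suc N)
  long-last : List ℕ → Bool
  long-last w = 2 <ᵇ length (lastCycle (cycles w))
  long : ∀ k → count (λ w → zpred k w ∧ long-last w) (perms (suc N)) ≡ ΣP (suc i) N (λ ℓ → zij N i ℓ) k
  long k = sym (trans (sum-zij-over-end N i (suc i) N k)
    (count-transfer (ExtendLastCycle.bijection N k i 1≤i) (λ P → admissible-∧⇔ P (T-∧-⇔ T-≡ᵇ⇔ T-inRangeᵇ⇔)) (λ P → T-∧-⇔ (lastCycleIs⇔ P) T-<ᵇ⇔)))
  short : ∀ k → count (λ w → zpred k w ∧ not (long-last w)) (perms (suc N)) ≡ (y* ΣP 1 (i ∸ 1) (λ ℓ → zij N ℓ i)) k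
  short zero = count-none _ (perms (suc N)) λ {w} w∈ t →
    LastCycleIs-zero (cycles w) 1≤i (Equivalence.to (lastCycleIs⇔ (perms-∈⁻ {suc N} w∈)) (proj₁ (T-∧⁻ {zpred 0 w} t)))
  short (suc k) = sym (trans (sum-zij-over-head N i 1 (i ∸ 1) k)
    (count-transfer (MoveToNewCycle.bijection N k i 1≤i i<N) (λ P → admissible-∧⇔ P (T-∧-⇔ T-≡ᵇ⇔ T-inRangeᵇ⇔))
      (λ P → T-∧-⇔ (lastCycleIs⇔ P) (T-not⇔ T-<ᵇ⇔))))

zij-last-pair : ∀ m → zij (suc (suc m)) (suc m) (suc (suc m)) ≈P y* (z m)
zij-last-pair m zero    = count-none _ (perms (suc (suc m))) λ {w} w∈ t →
  LastCycleIs-zero (cycles w) (s≤s z≤n) (Equivalence.to (lastCycleIs⇔ (perms-∈⁻ {suc (suc m)} w∈)) t)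
zij-last-pair m (suc k) = sym (count-transfer (TopCycle.bijection m k) (λ P → admissible⇔ P) (λ P → lastCycleIs⇔ P))

zij-2-1-2 : zij 2 1 2 ≈P yP
zij-2-1-2 zero          = refl
zij-2-1-2 (suc zero)    = refl
zij-2-1-2 (suc (suc k)) = refl

lemma3p1 : (∀ n i j → 3 ≤ n → 1 ≤ i → i < j → j ≤ n ∸ 1 →
        zij n i j ≈P ΣP j (n ∸ 1) (λ ℓ → zij (n ∸ 1) i ℓ))
    × (∀ n i → 3 ≤ n → 1 ≤ i → i ≤ n ∸ 2 →
        zij n i n ≈P (ΣP (suc i) (n ∸ 1) (λ ℓ → zij (n ∸ 1) i ℓ)
                      +P y* (ΣP 1 (i ∸ 1) (λ ℓ → zij (n ∸ 1) ℓ i))))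
    × (∀ n → 3 ≤ n → zij n (n ∸ 1) n ≈P y* (z (n ∸ 2)))
    × (zij 2 1 2 ≈P yP)
lemma3p1 = (λ { (suc N) i j _ → zij-j<n N i j })
         , (λ { (suc zero) _ (s≤s ()) ; (suc (suc N)) i _ 1≤i i≤N → zij-j≡n (suc N) i 1≤i (s≤s i≤N) })
         , (λ { (suc zero) (s≤s ()) ; (suc (suc m)) _ → zij-last-pair m })
         , zij-2-1-2
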